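{- Assume the setting of the context. For every order ideal $\mathcal{I}$ of $S$, the complex $\mathbf{L}^\bullet(\mathcal{I})$ satisfies $H^n(\mathbf{L}^\bullet(\mathcal{I}))=0$ for $n\ne0$, and the map $\mathfrak{u}:[a,\emptyset]\mapsto[a]$ induces an isomorphism $H^0(\mathbf{L}^\bullet(\mathcal{I}))\cong U_S(\mathcal{I})$.
   Context: $S$ is a finite set with a fixed total order $<$; $\{\ell_i:i\in S\}$ distinct odd primes; $r_T=\prod_{i\in T}\ell_i$ for $T\subseteq S$, $r=r_S$. $U_S$ is the quotient of the free abelian group on symbols $[a]$, $a\in\frac1r\mathbb{Z}/\mathbb{Z}$, by the subgroup generated by all $[a]-\sum_{b\in\mathbb{Q}/\mathbb{Z},\,\ell_ib=a}[b]$ ($i\in S$, $a\in\frac{\ell_i}{r}\mathbb{Z}/\mathbb{Z}$). For $T\subseteq S$, $U_T\subseteq U_S$ is the subgroup generated by the $[a]$ with $a\in\frac{1}{r_T}\mathbb{Z}/\mathbb{Z}$. An order ideal of $S$ is a family $\mathcal{I}$ of subsets of $S$ closed under taking subsets; $U_S(\mathcal{I})=\sum_{T\in\mathcal{I}}U_T$. Let $\mathbf{L}^\bullet$ be the free abelian group on symbols $[a,T]$ with $T\subseteq S$ and $a\in\frac{r_T}{r}\mathbb{Z}/\mathbb{Z}$, $[a,T]$ placed in degree $-|T|$, with differential \[d[a,T]=\sum_{i\in T}\omega(i,T)\Big([a,T\setminus\{i\}]-\sum_{b\in\mathbb{Q}/\mathbb{Z},\ \ell_ib=a}[b,T\setminus\{i\}]\Big),\quad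 \omega(i,T)=(-1)^{|\{j\in T:j<i\}|}.\] For $T\subseteq S$, $\mathbf{L}^\bullet_T\subseteq\mathbf{L}^\bullet$ is the subcomplex spanned by the $[a,T']$ with $T'\subseteq T$ and $a\in\frac{r_{T'}}{r_T}\mathbb{Z}/\mathbb{Z}$, and $\mathbf{L}^\bullet(\mathcal{I})=\sum_{T\in\mathcal{I}}\mathbf{L}^\bullet_T$. The map $\mathfrak{u}$ is defined on the degree-$0$ part, spanned by the $[a,\emptyset]$. -}

module Defs where

open import Data.Nat as ℕ using (ℕ; zero; suc)
open import Data.Nat.Divisibility using (_∣_)
open import Data.Integer as ℤ using (ℤ; +_; 0ℤ; 1ℤ)
import Data.Integer.Divisibility.Signed as ℤD
open import Data.Bool using (Bool; true; false; if_then_else_)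
open import Data.Fin as Fin using (Fin; toℕ)
open import Data.Fin.Subset using (Subset; inside; outside; _∈_; _⊆_; ⊥; ⊤; ∁; _∩_; _-_; ∣_∣)
open import Data.Fin.Subset.Properties using (_∈?_)
open import Data.Vec as Vec using (Vec; []; _∷_; tabulate)
open import Data.Vec.Properties using (≡-dec)
open import Data.List as List using (List; length; lookup)
open import Data.List.Membership.Propositional as LM using ()
open import Data.Product using (Σ; ∃; _×_)
open import Relation.Nullary using (Dec; yes; no; ¬_)
open import Relation.Nullary.Decidable using (⌊_⌋)
open import Relation.Binary.PropositionalEquality using (_≡_)
import Data.Bool.Properties as BoolP

ind : ∀ {p} {P : Set p} → Dec P → ℤ
ind (yes _) = 1ℤ
ind (no _)  = 0ℤ

sumFin : (n : ℕ) → (Fin n → ℤ) → ℤ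
sumFin zero    f = 0ℤ
sumFin (suc n) f = f Fin.zero ℤ.+ sumFin n (λ j → f (Fin.suc j))

sumSub : (n : ℕ) → (Subset n → ℤ) → ℤ
sumSub zero    f = f []
sumSub (suc n) f = sumSub n (λ T → f (outside ∷ T)) ℤ.+ sumSub n (λ T → f (inside ∷ T))

prodSub : ∀ {n} → Subset n → (Fin n → ℕ) → ℕ
prodSub []          f = 1
prodSub (b ∷ T) f = (if b then f Fin.zero else 1) ℕ.* prodSub T (λ i → f (Fin.suc i))

sgn : ℕ → ℤ
sgn zero    = 1ℤ
sgn (suc n) = ℤ.- sgn n

_≟S_ : ∀ {n} (T T' : Subset n) → Dec (T ≡ T')
_≟S_ = ≡-dec BoolP._≟_

OrderIdeal : ∀ {k} → List (Subset k) → Set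
OrderIdeal {k} I = ∀ {T T' : Subset k} → T LM.∈ I → T' ⊆ T → T' LM.∈ I

-- The setting: S = Fin k with its standard order, primes ℓ i.
-- An element a = x / r of (1/r)ℤ/ℤ is represented by its numerator x : Fin r.

module Setup (k : ℕ) (ℓ : Fin k → ℕ) where

  rT : Subset k → ℕ
  rT T = prodSub T ℓ

  r : ℕ
  r = rT ⊤

  Num : Set
  Num = Fin r

  -- "ℓ_i · (y/r) = x/r in ℚ/ℤ", i.e. r ∣ ℓ_i y − x
  MulEq : (i : Fin k) (y x : Num) → Dec (+ r ℤD.∣ (+ (ℓ i ℕ.* toℕ y) ℤ.- + toℕ x))
  MulEq i y x = + r ℤD.∣? (+ (ℓ i ℕ.* toℕ y) ℤ.- + toℕ x)

  -- The free abelian group on the symbols [a], a ∈ (1/r)ℤ/ℤ, and U_S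

  FreeU : Set
  FreeU = Num → ℤ

  zeroU : FreeU
  zeroU _ = 0ℤ

  -- the relation  [a] − Σ_{ℓ_i b = a} [b]  for a = x/r (only used when ℓ_i ∣ x)
  rel : Fin k → Num → FreeU
  rel i x y = ind (y Fin.≟ x) ℤ.- ind (MulEq i y x)

  -- membership in the relation subgroup (generated by rel i x with
  -- x/r ∈ (ℓ_i/r)ℤ/ℤ, i.e. ℓ_i ∣ x)
  InRel : FreeU → Set
  InRel f = Σ (Fin k → Num → ℤ) λ c →
              (∀ i x → ¬ (ℓ i ∣ toℕ x) → c i x ≡ 0ℤ) ×
              (∀ y → f y ≡ sumFin k (λ i → sumFin r (λ x → c i x ℤ.* rel i x y)))

  _~_ : FreeU → FreeU → Set
  f ~ g = InRel (λ y → f y ℤ.- g y)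

  -- representatives of elements of U_T : combinations of [a], a ∈ (1/r_T)ℤ/ℤ,
  -- i.e. numerators x with r/r_T = r_{S∖T} ∣ x
  InUT : Subset k → FreeU → Set
  InUT T g = ∀ x → ¬ (rT (∁ T) ∣ toℕ x) → g x ≡ 0ℤ

  -- the class of f lies in U_S(I) = Σ_{T ∈ I} U_T
  InUI : List (Subset k) → FreeU → Set
  InUI I f = Σ (Fin (length I) → FreeU) λ gs →
               (∀ j → InUT (lookup I j) (gs j)) ×
               (f ~ (λ x → sumFin (length I) (λ j → gs j x)))

  -- The complex L^•: free abelian group on [a,T], a = x/r ∈ (r_T/r)ℤ/ℤ

  Chain : Set
  Chain = Subset k → Num → ℤ

  zeroC : Chain
  zeroC _ _ = 0ℤ

  _≈C_ : Chain → Chain → Set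
  c ≈C c' = ∀ T x → c T x ≡ c' T x

  -- c is homogeneous of degree −n (supported on the [a,T] with |T| = n)
  Homog : ℕ → Chain → Set
  Homog n c = ∀ T x → ¬ (∣ T ∣ ≡ n) → c T x ≡ 0ℤ

  below : Fin k → Subset k
  below i = tabulate (λ j → if ⌊ j Fin.<? i ⌋ then inside else outside)

  ω : Fin k → Subset k → ℤ
  ω i T = sgn ∣ T ∩ below i ∣

  -- coefficient of [y/r, T'] in d[x/r, T]
  dgen : Subset k → Num → Subset k → Num → ℤ
  dgen T x T' y =
    sumFin k (λ i → ind (i ∈? T) ℤ.* (ω i T ℤ.*
      (ind (T' ≟S (T - i)) ℤ.* (ind (y Fin.≟ x) ℤ.- ind (MulEq i y x)))))

  dd : Chain → Chain
  dd c T' y = sumSub k (λ T → sumFin r (λ x → c T x ℤ.* dgen T x T' y))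

  -- L_T : spanned by the [a,T'] with T' ⊆ T and a ∈ (r_{T'}/r_T)ℤ/ℤ,
  -- i.e. numerator x divisible by r_{T'} · (r / r_T) = r_{T'} · r_{S∖T}
  InLT : Subset k → Chain → Set
  InLT T c = ∀ T' x → ¬ (T' ⊆ T × (rT T' ℕ.* rT (∁ T)) ∣ toℕ x) → c T' x ≡ 0ℤ

  InL : List (Subset k) → Chain → Set
  InL I c = Σ (Fin (length I) → Chain) λ cs →
              (∀ j → InLT (lookup I j) (cs j)) ×
              (c ≈C (λ T x → sumFin (length I) (λ j → cs j T x)))

  u : Chain → FreeU
  u c x = c ⊥ x

{-# OPTIONS --safe #-}
-- A generator [y/r, T] of L is a cell (T, y) with every ℓ_j, j ∈ T, dividing y; call
-- T ∪ {j | ℓ_j ∤ y} its type. The differential never raises the type, so L and every L(I) are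
-- filtered by types, and the type-preserving part δ of d is contracted one prime m of the type at
-- a time: the homotopy pairs (T, y), m ∉ T, with (T ∪ {m}, ℓ_m y), where among the ℓ_m-th roots
-- of ℓ_m y modulo r it picks the one congruent to r_T modulo ℓ_m. Peeling off the types of
-- L(K) ∖ L(J) one by one, in an order refining inclusion, then shows that L(K)/L(J) has no
-- cohomology in negative degrees. With J empty this is the vanishing of H^n(L(I)) for n ≠ 0. In
-- degree 0 the boundaries of L(S) are exactly the relations defining U_S, so taking K = all
-- subsets and J = I gives the injectivity of H^0(L(I)) → U_S(I); surjectivity is immediate.
module Submission where

open import Defs
open import Data.Nat using (ℕ; suc)
open import Data.Nat.Divisibility using (_∣_)
open import Data.Nat.Primality using (Prime)
open import Data.Fin using (Fin)
open import Data.Fin.Subset using (Subset)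
open import Data.List using (List)
open import Data.Product using (Σ; _×_)
open import Relation.Nullary using (¬_)
open import Relation.Binary.PropositionalEquality using (_≡_)
open import Function.Definitions using (Injective)

import Algebra.Properties.CommutativeSemigroup
open import Data.Bool using (if_then_else_)
import Data.Empty as Empty
open import Data.Fin using (toℕ; zero; suc; fromℕ<; _<_; _<?_)
import Data.Fin.Properties as FinP
open import Data.Fin.Subset as Sub using (inside; outside; _∈_; _∉_; _⊆_; ⊥; ⊤; ∁; _∩_; _∪_; ⁅_⁆; ∣_∣)
  renaming (_-_ to _∖_)
open import Data.Fin.Subset.Properties as SubP using (_∈?_)
open import Data.Integer as ℤ using (ℤ; +_; 0ℤ; 1ℤ; -1ℤ; _+_; _*_; -_; _-_)
import Data.Integer.DivMod as ℤ
open import Data.Integer.Divisibility.Signed as ℤD using (divides)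
import Data.Integer.Properties as ℤP
open import Data.Integer.Solver using (module +-*-Solver)
open import Data.List using (length; lookup)
import Data.List.Membership.Propositional as LM
open import Data.List.Membership.Propositional.Properties using (∈-lookup)
import Data.List.Relation.Unary.Any as Any
open import Data.List.Relation.Unary.Any.Properties using (lookup-index)
open import Data.Nat as ℕ using (zero)
open import Data.Nat.Coprimality using (Coprime; coprime-divisor; coprime-Bézout)
open import Data.Nat.Divisibility as ℕD using (_∣?_)
open import Data.Nat.GCD using (module Bézout)
open import Data.Nat.Primality using (prime⇒irreducible; euclidsLemma; ¬prime[1]; prime⇒nonZero)
import Data.Nat.Properties as ℕP
open import Data.Product using (_,_; proj₁; proj₂; ∃; map₂)
open import Data.Sum using (_⊎_; inj₁; inj₂; [_,_]′)
import Data.Unit as Unit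
open import Data.Vec using ([]; _∷_; here; there; tabulate)
import Data.Vec.Properties as VecP
open import Function using (_∘_)
open import Relation.Binary using (Setoid)
import Relation.Binary.Reasoning.Setoid
open import Relation.Binary.PropositionalEquality
  using (refl; sym; trans; cong; cong₂; subst; subst₂; module ≡-Reasoning)
open import Relation.Nullary using (Dec; yes; no; contradiction; ¬?)
open import Relation.Nullary.Decidable using (decidable-stable; map′; ⌊_⌋; _⊎-dec_; _×-dec_)

open +-*-Solver using (solve; _:=_; _:+_; _:*_; :-_; _:-_; con)
module ℕ* = Algebra.Properties.CommutativeSemigroup ℕP.*-commutativeSemigroup

private variable n : ℕ

when : {P : Set} → Dec P → ℤ → ℤ
when (yes _) a = a
when (no _)  _ = 0ℤ

unless : {P : Set} → Dec P → ℤ → ℤ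
unless (yes _) _ = 0ℤ
unless (no _)  a = a

when-yes : {P : Set} (d : Dec P) {a : ℤ} → P → when d a ≡ a
when-yes (yes _) p = refl
when-yes (no ¬p) p = contradiction p ¬p

when-no : {P : Set} (d : Dec P) {a : ℤ} → ¬ P → when d a ≡ 0ℤ
when-no (yes p) ¬p = contradiction p ¬p
when-no (no _)  ¬p = refl

when-≢0 : {P : Set} (d : Dec P) {a : ℤ} → ¬ when d a ≡ 0ℤ → P × ¬ a ≡ 0ℤ
when-≢0 (yes p) w≢0 = p , w≢0
when-≢0 (no _)  w≢0 = contradiction refl w≢0

unless-yes : {P : Set} (d : Dec P) {a : ℤ} → P → unless d a ≡ 0ℤ
unless-yes (yes _) p = refl
unless-yes (no ¬p) p = contradiction p ¬p

unless-no : {P : Set} (d : Dec P) {a : ℤ} → ¬ P → unless d a ≡ a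
unless-no (yes p) ¬p = contradiction p ¬p
unless-no (no _)  ¬p = refl

unless-≢0 : {P : Set} (d : Dec P) {a : ℤ} → ¬ unless d a ≡ 0ℤ → ¬ P × ¬ a ≡ 0ℤ
unless-≢0 (yes _)  u≢0 = contradiction refl u≢0
unless-≢0 (no ¬p) u≢0 = ¬p , u≢0

when-0 : {P : Set} (d : Dec P) → when d 0ℤ ≡ 0ℤ
when-0 (yes _) = refl
when-0 (no _)  = refl

unless-0 : {P : Set} (d : Dec P) → unless d 0ℤ ≡ 0ℤ
unless-0 (yes _) = refl
unless-0 (no _)  = refl

ind-yes : {P : Set} (d : Dec P) → P → ind d ≡ 1ℤ
ind-yes (yes _) _ = refl
ind-yes (no ¬p) p = contradiction p ¬p

ind-no : {P : Set} (d : Dec P) → ¬ P → ind d ≡ 0ℤ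
ind-no (yes p) ¬p = contradiction p ¬p
ind-no (no _)  _  = refl

*-distribˡ-- : ∀ a b c → a * (b - c) ≡ a * b - a * c
*-distribˡ-- = solve 3 (λ a b c → a :* (b :- c) := a :* b :- a :* c) refl

unless-unless-vanishes : {P Q : Set} (d : Dec P) (e : Dec Q) (a : ℤ) {v : ℤ} → v ≡ 0ℤ → unless d (unless e (- (a * v))) ≡ 0ℤ
unless-unless-vanishes d e a refl = trans
  (cong (λ v → unless d (unless e (- v))) (ℤP.*-zeroʳ a)) (trans (cong (unless d) (unless-0 e)) (unless-0 d))

≡0-stable : (a : ℤ) → ¬ ¬ a ≡ 0ℤ → a ≡ 0ℤ
≡0-stable a = decidable-stable (a ℤ.≟ 0ℤ)

≢0-+ : ∀ a b → ¬ a + b ≡ 0ℤ → ¬ a ≡ 0ℤ ⊎ ¬ b ≡ 0ℤ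
≢0-+ a b a+b≢0 with a ℤ.≟ 0ℤ
... | no a≢0  = inj₁ a≢0
... | yes refl = inj₂ (λ b≡0 → a+b≢0 (trans (ℤP.+-identityˡ b) b≡0))

≢0-- : ∀ a b → ¬ a - b ≡ 0ℤ → ¬ a ≡ 0ℤ ⊎ ¬ b ≡ 0ℤ
≢0-- a b a-b≢0 with ≢0-+ a (- b) a-b≢0
... | inj₁ a≢0  = inj₁ a≢0
... | inj₂ -b≢0 = inj₂ (λ b≡0 → -b≢0 (cong -_ b≡0))

≢0-*ʳ : ∀ a b → ¬ a * b ≡ 0ℤ → ¬ b ≡ 0ℤ
≢0-*ʳ a b ab≢0 b≡0 = ab≢0 (trans (cong (a *_) b≡0) (ℤP.*-zeroʳ a))

≢0-neg : ∀ a → ¬ - a ≡ 0ℤ → ¬ a ≡ 0ℤ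
≢0-neg a -a≢0 a≡0 = -a≢0 (cong -_ a≡0)

module _ where
  open import Algebra.Properties.Semiring.Sum ℤP.+-*-semiring
    using (sum; ∑-distrib-+; ∑-comm; *-distribˡ-sum)

  sumFin≡sum : ∀ n (f : Fin n → ℤ) → sumFin n f ≡ sum f
  sumFin≡sum zero    f = refl
  sumFin≡sum (suc n) f = cong (_+_ (f zero)) (sumFin≡sum n (f ∘ suc))

  sumFin-cong : ∀ n {f g : Fin n → ℤ} → (∀ x → f x ≡ g x) → sumFin n f ≡ sumFin n g
  sumFin-cong zero    f≗g = refl
  sumFin-cong (suc n) f≗g = cong₂ _+_ (f≗g zero) (sumFin-cong n (f≗g ∘ suc))

  sumFin-+ : ∀ n (f g : Fin n → ℤ) → sumFin n (λ x → f x + g x) ≡ sumFin n f + sumFin n g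
  sumFin-+ n f g = begin
    sumFin n (λ x → f x + g x)  ≡⟨ sumFin≡sum n _ ⟩
    sum (λ x → f x + g x)       ≡⟨ ∑-distrib-+ f g ⟩
    sum f + sum g               ≡⟨ cong₂ _+_ (sumFin≡sum n f) (sumFin≡sum n g) ⟨
    sumFin n f + sumFin n g     ∎
    where open ≡-Reasoning

  sumFin-*ˡ : ∀ n a (f : Fin n → ℤ) → sumFin n (λ x → a * f x) ≡ a * sumFin n f
  sumFin-*ˡ n a f = begin
    sumFin n (λ x → a * f x)  ≡⟨ sumFin≡sum n _ ⟩
    sum (λ x → a * f x)       ≡⟨ *-distribˡ-sum a f ⟨
    a * sum f                 ≡⟨ cong (a *_) (sumFin≡sum n f) ⟨
    a * sumFin n f            ∎
    where open ≡-Reasoning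

  sumFin-comm : ∀ m n (f : Fin m → Fin n → ℤ) →
    sumFin m (λ i → sumFin n (f i)) ≡ sumFin n (λ j → sumFin m (λ i → f i j))
  sumFin-comm m n f = begin
    sumFin m (λ i → sumFin n (f i))          ≡⟨ sumFin-cong m (λ i → sumFin≡sum n (f i)) ⟩
    sumFin m (λ i → sum (f i))               ≡⟨ sumFin≡sum m _ ⟩
    sum (λ i → sum (f i))                    ≡⟨ ∑-comm f ⟩
    sum (λ j → sum (λ i → f i j))            ≡⟨ sumFin≡sum n _ ⟨
    sumFin n (λ j → sum (λ i → f i j))       ≡⟨ sumFin-cong n (λ j → sumFin≡sum m (λ i → f i j)) ⟨
    sumFin n (λ j → sumFin m (λ i → f i j))  ∎
    where open ≡-Reasoning

sumFin-neg : ∀ n (f : Fin n → ℤ) → sumFin n (λ x → - f x) ≡ - sumFin n f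
sumFin-neg zero    f = refl
sumFin-neg (suc n) f =
  trans (cong (_+_ (- f zero)) (sumFin-neg n (f ∘ suc))) (sym (ℤP.neg-distrib-+ (f zero) _))

sumFin-- : ∀ n (f g : Fin n → ℤ) → sumFin n (λ x → f x - g x) ≡ sumFin n f - sumFin n g
sumFin-- n f g = trans (sumFin-+ n f (λ x → - g x)) (cong (_+_ (sumFin n f)) (sumFin-neg n g))

sumFin-0 : ∀ n {f : Fin n → ℤ} → (∀ x → f x ≡ 0ℤ) → sumFin n f ≡ 0ℤ
sumFin-0 zero    f≗0 = refl
sumFin-0 (suc n) f≗0 = cong₂ _+_ (f≗0 zero) (sumFin-0 n (f≗0 ∘ suc))

sumFin-single : ∀ n {f : Fin n → ℤ} x₀ → (∀ x → ¬ x ≡ x₀ → f x ≡ 0ℤ) → sumFin n f ≡ f x₀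
sumFin-single (suc n) {f} zero f≗0 =
  trans (cong (_+_ (f zero)) (sumFin-0 n (λ x → f≗0 (suc x) λ ()))) (ℤP.+-identityʳ _)
sumFin-single (suc n) {f} (suc x₀) f≗0 =
  trans (cong₂ _+_ (f≗0 zero λ ()) (sumFin-single n x₀ λ x x≢x₀ → f≗0 (suc x) (x≢x₀ ∘ FinP.suc-injective)))
        (ℤP.+-identityˡ _)

sumFin-≢0 : ∀ n (f : Fin n → ℤ) → ¬ sumFin n f ≡ 0ℤ → ∃ λ x → ¬ f x ≡ 0ℤ
sumFin-≢0 zero    f Σ≢0 = contradiction refl Σ≢0
sumFin-≢0 (suc n) f Σ≢0 with ≢0-+ (f zero) _ Σ≢0
... | inj₁ f₀≢0 = zero , f₀≢0
... | inj₂ rest≢0 with sumFin-≢0 n (f ∘ suc) rest≢0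
...   | x , fx≢0 = suc x , fx≢0

sumFin-agree-off : ∀ n {f g : Fin n → ℤ} x₀ → (∀ x → ¬ x ≡ x₀ → f x ≡ g x) →
  sumFin n f - sumFin n g ≡ f x₀ - g x₀
sumFin-agree-off n {f} {g} x₀ f≗g = trans (sym (sumFin-- n f g))
  (sumFin-single n x₀ λ x x≢x₀ → trans (cong (_- g x) (f≗g x x≢x₀)) (ℤP.+-inverseʳ (g x)))

sumFin-antisym : ∀ n (F : Fin n → Fin n → ℤ) → (∀ i j → F i j ≡ - F j i) →
  sumFin n (λ i → sumFin n (F i)) ≡ 0ℤ
sumFin-antisym n F anti = self-negative (begin
  sumFin n (λ i → sumFin n (F i))          ≡⟨ sumFin-comm n n F ⟩
  sumFin n (λ j → sumFin n (λ i → F i j))  ≡⟨ sumFin-cong n (λ j → sumFin-cong n (λ i → anti i j)) ⟩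
  sumFin n (λ j → sumFin n (λ i → - F j i)) ≡⟨ sumFin-cong n (λ j → sumFin-neg n (F j)) ⟩
  sumFin n (λ j → - sumFin n (F j))        ≡⟨ sumFin-neg n _ ⟩
  - sumFin n (λ j → sumFin n (F j))        ∎)
  where
  open ≡-Reasoning
  self-negative : ∀ {a} → a ≡ - a → a ≡ 0ℤ
  self-negative {+ zero}     _  = refl
  self-negative {+ suc _}    ()
  self-negative {ℤ.-[1+ _ ]} ()

sumFin-ind : ∀ n (C : Fin n → ℤ) {P : Fin n → Set} (P? : ∀ x → Dec (P x)) x₀ → P x₀ →
  (∀ {x} → P x → x ≡ x₀) → sumFin n (λ x → C x * ind (P? x)) ≡ C x₀
sumFin-ind n C P? x₀ Px₀ unique = trans (sumFin-single n x₀ off) (trans (cong (C x₀ *_) (ind-yes (P? x₀) Px₀)) (ℤP.*-identityʳ _))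
  where
  off : ∀ x → ¬ x ≡ x₀ → C x * ind (P? x) ≡ 0ℤ
  off x x≢x₀ = trans (cong (C x *_) (ind-no (P? x) (x≢x₀ ∘ unique))) (ℤP.*-zeroʳ (C x))

unless-sumFin : ∀ {P : Set} (d : Dec P) n (f : Fin n → ℤ) → unless d (sumFin n f) ≡ sumFin n (λ j → unless d (f j))
unless-sumFin (yes _) n f = sym (sumFin-0 n (λ _ → refl))
unless-sumFin (no _)  n f = refl

antisym-by-cases : ∀ {P : Fin n → Set} (P? : ∀ i → Dec (P i)) (F : Fin n → Fin n → ℤ) →
  (∀ i j → P i → F i j ≡ 0ℤ) → (∀ i j → P i → F j i ≡ 0ℤ) → (∀ i → F i i ≡ 0ℤ) →
  (∀ i j → ¬ P i → ¬ P j → ¬ i ≡ j → F i j ≡ - F j i) →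
  ∀ i j → F i j ≡ - F j i
antisym-by-cases P? F zeroˡ zeroʳ diagonal generic i j with P? i | P? j | i FinP.≟ j
... | yes Pi  | _       | _        = both-zero (zeroˡ i j Pi) (zeroʳ i j Pi)
  where
  both-zero : ∀ {a b} → a ≡ 0ℤ → b ≡ 0ℤ → a ≡ - b
  both-zero a≡0 b≡0 = trans a≡0 (cong -_ (sym b≡0))
... | no _    | yes Pj  | _        = trans (zeroʳ j i Pj) (cong -_ (sym (zeroˡ j i Pj)))
... | no _    | no _    | yes refl = trans (diagonal i) (cong -_ (sym (diagonal i)))
... | no ¬Pi  | no ¬Pj  | no i≢j   = generic i j ¬Pi ¬Pj i≢j

sumSub-cong : ∀ n {f g : Subset n → ℤ} → (∀ T → f T ≡ g T) → sumSub n f ≡ sumSub n g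
sumSub-cong zero    f≗g = f≗g []
sumSub-cong (suc n) f≗g =
  cong₂ _+_ (sumSub-cong n (f≗g ∘ (outside ∷_))) (sumSub-cong n (f≗g ∘ (inside ∷_)))

sumSub-0 : ∀ n {f : Subset n → ℤ} → (∀ T → f T ≡ 0ℤ) → sumSub n f ≡ 0ℤ
sumSub-0 zero    f≗0 = f≗0 []
sumSub-0 (suc n) f≗0 = cong₂ _+_ (sumSub-0 n (f≗0 ∘ (outside ∷_))) (sumSub-0 n (f≗0 ∘ (inside ∷_)))

sumSub-single : ∀ n {f : Subset n → ℤ} T₀ → (∀ T → ¬ T ≡ T₀ → f T ≡ 0ℤ) → sumSub n f ≡ f T₀
sumSub-single zero    []            f≗0 = refl
sumSub-single (suc n) (outside ∷ T₀) f≗0 = trans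
  (cong₂ _+_ (sumSub-single n T₀ λ T T≢T₀ → f≗0 (outside ∷ T) (T≢T₀ ∘ cong Data.Vec.tail))
             (sumSub-0 n λ T → f≗0 (inside ∷ T) λ ()))
  (ℤP.+-identityʳ _)
sumSub-single (suc n) (inside ∷ T₀) f≗0 = trans
  (cong₂ _+_ (sumSub-0 n λ T → f≗0 (outside ∷ T) λ ())
             (sumSub-single n T₀ λ T T≢T₀ → f≗0 (inside ∷ T) (T≢T₀ ∘ cong Data.Vec.tail)))
  (ℤP.+-identityˡ _)

sumSub-sumFin : ∀ n m (f : Subset n → Fin m → ℤ) →
  sumSub n (λ T → sumFin m (f T)) ≡ sumFin m (λ j → sumSub n (λ T → f T j))
sumSub-sumFin zero    m f = refl
sumSub-sumFin (suc n) m f = trans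
  (cong₂ _+_ (sumSub-sumFin n m (f ∘ (outside ∷_))) (sumSub-sumFin n m (f ∘ (inside ∷_))))
  (sym (sumFin-+ m _ _))

subsetOf : ∀ {P : Fin n → Set} → (∀ j → Dec (P j)) → Subset n
subsetOf P? = tabulate λ j → if ⌊ P? j ⌋ then inside else outside

module _ {P : Fin n → Set} (P? : ∀ j → Dec (P j)) {j : Fin n} where

  ∈-subsetOf⁺ : P j → j ∈ subsetOf P?
  ∈-subsetOf⁺ Pj = VecP.lookup⇒[]= j _ (trans (VecP.lookup∘tabulate _ j) (is-inside (P? j)))
    where
    is-inside : (d : Dec (P j)) → (if ⌊ d ⌋ then inside else outside) ≡ inside
    is-inside (yes _)  = refl
    is-inside (no ¬Pj) = contradiction Pj ¬Pj

  ∈-subsetOf⁻ : j ∈ subsetOf P? → P j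
  ∈-subsetOf⁻ j∈ = witness (P? j) (trans (sym (VecP.lookup∘tabulate _ j)) (VecP.[]=⇒lookup j∈))
    where
    witness : (d : Dec (P j)) → (if ⌊ d ⌋ then inside else outside) ≡ inside → P j
    witness (yes Pj) _ = Pj

module _ {p : Subset n} where

  x∈p∪⁅x⁆ : ∀ x → x ∈ p ∪ ⁅ x ⁆
  x∈p∪⁅x⁆ x = SubP.x∈p∪q⁺ (inj₂ (SubP.x∈⁅x⁆ x))

  x∈p⇒x∈p∪⁅y⁆ : ∀ {x} y → x ∈ p → x ∈ p ∪ ⁅ y ⁆
  x∈p⇒x∈p∪⁅y⁆ y x∈p = SubP.x∈p∪q⁺ (inj₁ x∈p)

  x∈p∪⁅y⁆⁻ : ∀ {x} y → x ∈ p ∪ ⁅ y ⁆ → x ≡ y ⊎ x ∈ p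
  x∈p∪⁅y⁆⁻ y x∈ with SubP.x∈p∪q⁻ p ⁅ y ⁆ x∈
  ... | inj₁ x∈p   = inj₂ x∈p
  ... | inj₂ x∈⁅y⁆ = inj₁ (SubP.x∈⁅y⁆⇒x≡y y x∈⁅y⁆)

x∉p⇒x∉p∪⁅y⁆ : ∀ {p : Subset n} {x y} → x ∉ p → ¬ x ≡ y → x ∉ p ∪ ⁅ y ⁆
x∉p⇒x∉p∪⁅y⁆ {y = y} x∉p x≢y x∈ with x∈p∪⁅y⁆⁻ y x∈
... | inj₁ x≡y = x≢y x≡y
... | inj₂ x∈p = x∉p x∈p

x∈p─q⇒x∉q : ∀ {p q : Subset n} {x} → x ∈ p Sub.─ q → x ∉ q
x∈p─q⇒x∉q {p = _ ∷ _} {outside ∷ _} {zero}  _          ()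
x∈p─q⇒x∉q {p = _ ∷ _} {inside ∷ _}  {zero}  ()
x∈p─q⇒x∉q {p = _ ∷ _} {_ ∷ _}       {suc _} (there x∈) (there x∈q) = x∈p─q⇒x∉q x∈ x∈q

x∉p∖x : ∀ (p : Subset n) x → x ∉ p ∖ x
x∉p∖x p x x∈ = x∈p─q⇒x∉q x∈ (SubP.x∈⁅x⁆ x)

x∈p∖y⁻ : ∀ {p : Subset n} {x y} → x ∈ p ∖ y → x ∈ p × ¬ x ≡ y
x∈p∖y⁻ {p = p} {y = y} x∈ = SubP.p─q⊆p p ⁅ y ⁆ x∈ , λ { refl → x∉p∖x p y x∈ }

x∉p⇒∣p∪⁅x⁆∣≡1+∣p∣ : ∀ {p : Subset n} {x} → x ∉ p → ∣ p ∪ ⁅ x ⁆ ∣ ≡ suc ∣ p ∣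
x∉p⇒∣p∪⁅x⁆∣≡1+∣p∣ {p = outside ∷ p} {zero}  _   = cong (suc ∘ ∣_∣) (SubP.∪-identityʳ p)
x∉p⇒∣p∪⁅x⁆∣≡1+∣p∣ {p = inside ∷ _}  {zero}  x∉p = contradiction here x∉p
x∉p⇒∣p∪⁅x⁆∣≡1+∣p∣ {p = outside ∷ _} {suc _} x∉p = x∉p⇒∣p∪⁅x⁆∣≡1+∣p∣ (x∉p ∘ there)
x∉p⇒∣p∪⁅x⁆∣≡1+∣p∣ {p = inside ∷ _}  {suc _} x∉p = cong suc (x∉p⇒∣p∪⁅x⁆∣≡1+∣p∣ (x∉p ∘ there))

module _ {p : Subset n} {x : Fin n} where

  x∉p⇒p∪⁅x⁆∖x≡p : x ∉ p → (p ∪ ⁅ x ⁆) ∖ x ≡ p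
  x∉p⇒p∪⁅x⁆∖x≡p x∉p =
    SubP.⊆-antisym ⊆p (λ y∈p → SubP.x∈p∧x≢y⇒x∈p-y (x∈p⇒x∈p∪⁅y⁆ x y∈p) λ { refl → x∉p y∈p })
    where
    ⊆p : (p ∪ ⁅ x ⁆) ∖ x ⊆ p
    ⊆p y∈ with x∈p∖y⁻ y∈
    ... | y∈ , y≢x with x∈p∪⁅y⁆⁻ x y∈
    ...   | inj₁ y≡x = contradiction y≡x y≢x
    ...   | inj₂ y∈p = y∈p

  x∈p⇒p∖x∪⁅x⁆≡p : x ∈ p → (p ∖ x) ∪ ⁅ x ⁆ ≡ p
  x∈p⇒p∖x∪⁅x⁆≡p x∈p = SubP.⊆-antisym ⊆p p⊆
    where
    ⊆p : (p ∖ x) ∪ ⁅ x ⁆ ⊆ p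
    ⊆p y∈ with x∈p∪⁅y⁆⁻ x y∈
    ... | inj₁ refl = x∈p
    ... | inj₂ y∈   = proj₁ (x∈p∖y⁻ y∈)
    p⊆ : p ⊆ (p ∖ x) ∪ ⁅ x ⁆
    p⊆ {y} y∈p with y FinP.≟ x
    ... | yes refl = x∈p∪⁅x⁆ x
    ... | no y≢x   = x∈p⇒x∈p∪⁅y⁆ x (SubP.x∈p∧x≢y⇒x∈p-y y∈p y≢x)

  x∈p⇒p∪⁅x⁆≡p : x ∈ p → p ∪ ⁅ x ⁆ ≡ p
  x∈p⇒p∪⁅x⁆≡p x∈p = SubP.⊆-antisym ⊆p (x∈p⇒x∈p∪⁅y⁆ x)
    where
    ⊆p : p ∪ ⁅ x ⁆ ⊆ p
    ⊆p y∈ with x∈p∪⁅y⁆⁻ x y∈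
    ... | inj₁ refl = x∈p
    ... | inj₂ y∈p  = y∈p

  x∈p⇒∣p∣≡1+∣p∖x∣ : x ∈ p → ∣ p ∣ ≡ suc ∣ p ∖ x ∣
  x∈p⇒∣p∣≡1+∣p∖x∣ x∈p =
    trans (cong ∣_∣ (sym (x∈p⇒p∖x∪⁅x⁆≡p x∈p))) (x∉p⇒∣p∪⁅x⁆∣≡1+∣p∣ (x∉p∖x p x))

p∪⁅x⁆∪q≡p∪q∪⁅x⁆ : ∀ (p q : Subset n) x → (p ∪ ⁅ x ⁆) ∪ q ≡ (p ∪ q) ∪ ⁅ x ⁆
p∪⁅x⁆∪q≡p∪q∪⁅x⁆ p q x = begin
  (p ∪ ⁅ x ⁆) ∪ q  ≡⟨ SubP.∪-assoc p ⁅ x ⁆ q ⟩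
  p ∪ (⁅ x ⁆ ∪ q)  ≡⟨ cong (p ∪_) (SubP.∪-comm ⁅ x ⁆ q) ⟩
  p ∪ (q ∪ ⁅ x ⁆)  ≡⟨ SubP.∪-assoc p q ⁅ x ⁆ ⟨
  (p ∪ q) ∪ ⁅ x ⁆  ∎
  where open ≡-Reasoning

x≢y⇒p∪⁅x⁆∖y≡p∖y∪⁅x⁆ : ∀ {p : Subset n} {x y} → ¬ x ≡ y → (p ∪ ⁅ x ⁆) ∖ y ≡ (p ∖ y) ∪ ⁅ x ⁆
x≢y⇒p∪⁅x⁆∖y≡p∖y∪⁅x⁆ {p = p} {x} {y} x≢y = SubP.⊆-antisym ⊆r ⊆l
  where
  ⊆r : (p ∪ ⁅ x ⁆) ∖ y ⊆ (p ∖ y) ∪ ⁅ x ⁆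
  ⊆r z∈ with x∈p∖y⁻ z∈
  ... | z∈′ , z≢y with x∈p∪⁅y⁆⁻ x z∈′
  ...   | inj₁ refl = x∈p∪⁅x⁆ x
  ...   | inj₂ z∈p  = x∈p⇒x∈p∪⁅y⁆ x (SubP.x∈p∧x≢y⇒x∈p-y z∈p z≢y)
  ⊆l : (p ∖ y) ∪ ⁅ x ⁆ ⊆ (p ∪ ⁅ x ⁆) ∖ y
  ⊆l z∈ with x∈p∪⁅y⁆⁻ x z∈
  ... | inj₁ refl = SubP.x∈p∧x≢y⇒x∈p-y (x∈p∪⁅x⁆ x) x≢y
  ... | inj₂ z∈   = SubP.x∈p∧x≢y⇒x∈p-y (x∈p⇒x∈p∪⁅y⁆ x (proj₁ (x∈p∖y⁻ z∈))) (proj₂ (x∈p∖y⁻ z∈))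

x∈q⇒p∪⁅x⁆∩q≡p∩q∪⁅x⁆ : ∀ (p : Subset n) {q x} → x ∈ q → (p ∪ ⁅ x ⁆) ∩ q ≡ (p ∩ q) ∪ ⁅ x ⁆
x∈q⇒p∪⁅x⁆∩q≡p∩q∪⁅x⁆ p {q} {x} x∈q =
  trans (SubP.∩-distribʳ-∪ q p ⁅ x ⁆) (cong ((p ∩ q) ∪_) (SubP.⊆-antisym (SubP.p∩q⊆p ⁅ x ⁆ q) ⁅x⁆⊆))
  where
  ⁅x⁆⊆ : ⁅ x ⁆ ⊆ ⁅ x ⁆ ∩ q
  ⁅x⁆⊆ y∈⁅x⁆ with SubP.x∈⁅y⁆⇒x≡y x y∈⁅x⁆
  ... | refl = SubP.x∈p∩q⁺ (y∈⁅x⁆ , x∈q)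

x∉q⇒p∪⁅x⁆∩q≡p∩q : ∀ (p : Subset n) {q x} → x ∉ q → (p ∪ ⁅ x ⁆) ∩ q ≡ p ∩ q
x∉q⇒p∪⁅x⁆∩q≡p∩q p {q} {x} x∉q = begin
  (p ∪ ⁅ x ⁆) ∩ q         ≡⟨ SubP.∩-distribʳ-∪ q p ⁅ x ⁆ ⟩
  (p ∩ q) ∪ (⁅ x ⁆ ∩ q)   ≡⟨ cong ((p ∩ q) ∪_) (SubP.Empty-unique λ (y , y∈) → empty y∈) ⟩
  (p ∩ q) ∪ ⊥             ≡⟨ SubP.∪-identityʳ (p ∩ q) ⟩
  p ∩ q                   ∎
  where
  open ≡-Reasoning
  empty : ∀ {y} → ¬ y ∈ ⁅ x ⁆ ∩ q
  empty y∈ with SubP.x∈p∩q⁻ ⁅ x ⁆ q y∈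
  ... | y∈⁅x⁆ , y∈q with SubP.x∈⁅y⁆⇒x≡y x y∈⁅x⁆
  ...   | refl = x∉q y∈q

∣p∣≡0⇒p≡⊥ : ∀ {p : Subset n} → ∣ p ∣ ≡ 0 → p ≡ ⊥
∣p∣≡0⇒p≡⊥ ∣p∣≡0 =
  SubP.Empty-unique λ (x , x∈p) → ℕP.0≢1+n (trans (sym ∣p∣≡0) (x∈p⇒∣p∣≡1+∣p∖x∣ x∈p))

⁅⁆-injective : ∀ {x y : Fin n} → ⊥ ∪ ⁅ x ⁆ ≡ ⊥ ∪ ⁅ y ⁆ → x ≡ y
⁅⁆-injective {x = x} {y} eq with x∈p∪⁅y⁆⁻ y (subst (x ∈_) eq (x∈p∪⁅x⁆ x))
... | inj₁ x≡y = x≡y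
... | inj₂ x∈⊥ = contradiction x∈⊥ SubP.∉⊥

rank : Subset n → ℕ
rank []            = 0
rank (inside ∷ p)  = suc (2 ℕ.* rank p)
rank (outside ∷ p) = 2 ℕ.* rank p

private
  1+2*-mono : ∀ {a b} → a ℕ.< b → suc (2 ℕ.* a) ℕ.< 2 ℕ.* b
  1+2*-mono {a} {b} a<b = subst (ℕ._≤ 2 ℕ.* b) (ℕP.*-suc 2 a) (ℕP.*-monoʳ-≤ 2 a<b)

rank-injective : ∀ {p q : Subset n} → rank p ≡ rank q → p ≡ q
rank-injective {p = []}          {[]}          _  = refl
rank-injective {p = inside ∷ p}  {inside ∷ q}  eq = cong (inside ∷_) (rank-injective (ℕP.*-cancelˡ-≡ _ _ 2 (ℕP.suc-injective eq)))
rank-injective {p = outside ∷ p} {outside ∷ q} eq = cong (outside ∷_) (rank-injective (ℕP.*-cancelˡ-≡ _ _ 2 eq))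
rank-injective {p = inside ∷ p}  {outside ∷ q} eq = contradiction (sym eq) (ℕP.even≢odd (rank q) (rank p))
rank-injective {p = outside ∷ p} {inside ∷ q}  eq = contradiction eq (ℕP.even≢odd (rank p) (rank q))

rank-⊂ : ∀ {p q : Subset n} → p ⊆ q → ¬ p ≡ q → rank p ℕ.< rank q
rank-⊂ {p = []} {[]} _ p≢q = contradiction refl p≢q
rank-⊂ {p = a ∷ p} {b ∷ q} a∷p⊆b∷q a∷p≢b∷q with p ≟S q | a | b
... | yes refl | outside | outside = contradiction refl a∷p≢b∷q
... | yes refl | inside  | inside  = contradiction refl a∷p≢b∷q
... | yes refl | outside | inside  = ℕP.n<1+n _
... | yes refl | inside  | outside = contradiction (a∷p⊆b∷q here) λ ()
... | no p≢q   | outside | outside = ℕP.*-monoʳ-< 2 (rank-⊂ (SubP.drop-∷-⊆ a∷p⊆b∷q) p≢q)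
... | no p≢q   | inside  | inside  = ℕ.s<s (ℕP.*-monoʳ-< 2 (rank-⊂ (SubP.drop-∷-⊆ a∷p⊆b∷q) p≢q))
... | no p≢q   | outside | inside  = ℕP.m<n⇒m<1+n (ℕP.*-monoʳ-< 2 (rank-⊂ (SubP.drop-∷-⊆ a∷p⊆b∷q) p≢q))
... | no p≢q   | inside  | outside = contradiction (a∷p⊆b∷q here) λ ()

rank<2^n : ∀ (p : Subset n) → rank p ℕ.< 2 ℕ.^ n
rank<2^n []            = ℕP.n<1+n 0
rank<2^n (inside ∷ p)  = 1+2*-mono (rank<2^n p)
rank<2^n (outside ∷ p) = ℕP.<-trans (ℕP.n<1+n _) (1+2*-mono (rank<2^n p))

prime∤1 : ∀ {p} → Prime p → ¬ p ∣ 1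
prime∤1 p-prime p∣1 = ¬prime[1] (subst Prime (ℕD.∣1⇒≡1 p∣1) p-prime)

prime∣prime⇒≡ : ∀ {p q} → Prime p → Prime q → p ∣ q → p ≡ q
prime∣prime⇒≡ p-prime q-prime p∣q with prime⇒irreducible q-prime p∣q
... | inj₁ refl = contradiction p-prime ¬prime[1]
... | inj₂ p≡q  = p≡q

prime∤⇒coprime : ∀ {p m} → Prime p → ¬ p ∣ m → Coprime p m
prime∤⇒coprime p-prime p∤m (d∣p , d∣m) with prime⇒irreducible p-prime d∣p
... | inj₁ d≡1  = d≡1
... | inj₂ refl = contradiction d∣m p∤m

coprime⇒*∣ : ∀ {a b x} → Coprime a b → a ∣ x → b ∣ x → a ℕ.* b ∣ x
coprime⇒*∣ {a} {b} coprime a∣x (ℕD.divides q refl) with coprime-divisor coprime (subst (a ∣_) (ℕP.*-comm q b) a∣x)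
... | ℕD.divides e refl = ℕD.divides e (ℕP.*-assoc e a b)

module _ where
  private variable A B : Subset n

  prodSub-∈ : ∀ (f : Fin n → ℕ) {i} → i ∈ A → f i ∣ prodSub A f
  prodSub-∈ {A = inside ∷ _} f here        = ℕD.m∣m*n _
  prodSub-∈ {A = b ∷ A}      f (there i∈A) =
    ℕD.∣-trans (prodSub-∈ (f ∘ suc) i∈A) (ℕD.n∣m*n (if b then f zero else 1))

  prodSub-⊥ : ∀ n (f : Fin n → ℕ) → prodSub ⊥ f ≡ 1
  prodSub-⊥ zero    f = refl
  prodSub-⊥ (suc n) f = trans (ℕP.*-identityˡ _) (prodSub-⊥ n (f ∘ suc))

  prodSub-∪⁅⁆ : ∀ (f : Fin n → ℕ) {i} → i ∉ A → prodSub (A ∪ ⁅ i ⁆) f ≡ f i ℕ.* prodSub A f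
  prodSub-∪⁅⁆ {A = outside ∷ A} f {zero} _ =
    cong (f zero ℕ.*_) (trans (cong (λ B → prodSub B (f ∘ suc)) (SubP.∪-identityʳ A)) (sym (ℕP.*-identityˡ _)))
  prodSub-∪⁅⁆ {A = inside ∷ _} f {zero} i∉A = contradiction here i∉A
  prodSub-∪⁅⁆ {A = outside ∷ A} f {suc i} i∉A = trans (ℕP.*-identityˡ _)
    (trans (prodSub-∪⁅⁆ (f ∘ suc) (i∉A ∘ there)) (cong (f (suc i) ℕ.*_) (sym (ℕP.*-identityˡ _))))
  prodSub-∪⁅⁆ {A = inside ∷ A} f {suc i} i∉A = begin
    f zero ℕ.* prodSub (A ∪ ⁅ i ⁆) (f ∘ suc)      ≡⟨ cong (f zero ℕ.*_) (prodSub-∪⁅⁆ (f ∘ suc) (i∉A ∘ there)) ⟩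
    f zero ℕ.* (f (suc i) ℕ.* prodSub A (f ∘ suc)) ≡⟨ ℕ*.x∙yz≈y∙xz (f zero) (f (suc i)) _ ⟩
    f (suc i) ℕ.* (f zero ℕ.* prodSub A (f ∘ suc)) ∎
    where open ≡-Reasoning

  prodSub-∪ : ∀ (f : Fin n → ℕ) → (∀ {j} → j ∈ A → j ∉ B) → prodSub A f ℕ.* prodSub B f ≡ prodSub (A ∪ B) f
  prodSub-∪ {A = []} {[]} f _ = refl
  prodSub-∪ {A = inside ∷ A} {inside ∷ B} f disjoint = contradiction here (disjoint here)
  prodSub-∪ {A = inside ∷ A} {outside ∷ B} f disjoint = begin
    (f zero ℕ.* pA) ℕ.* (1 ℕ.* pB) ≡⟨ cong ((f zero ℕ.* pA) ℕ.*_) (ℕP.*-identityˡ pB) ⟩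
    (f zero ℕ.* pA) ℕ.* pB         ≡⟨ ℕP.*-assoc (f zero) pA pB ⟩
    f zero ℕ.* (pA ℕ.* pB)         ≡⟨ cong (f zero ℕ.*_) (prodSub-∪ (f ∘ suc) λ j∈A → disjoint (there j∈A) ∘ there) ⟩
    f zero ℕ.* prodSub (A ∪ B) (f ∘ suc) ∎
    where
    open ≡-Reasoning
    pA pB : ℕ
    pA = prodSub A (f ∘ suc)
    pB = prodSub B (f ∘ suc)
  prodSub-∪ {A = outside ∷ A} {b ∷ B} f disjoint = begin
    (1 ℕ.* pA) ℕ.* (fb ℕ.* pB) ≡⟨ cong (ℕ._* (fb ℕ.* pB)) (ℕP.*-identityˡ pA) ⟩
    pA ℕ.* (fb ℕ.* pB)         ≡⟨ ℕ*.x∙yz≈y∙xz pA fb pB ⟩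
    fb ℕ.* (pA ℕ.* pB)         ≡⟨ cong (fb ℕ.*_) (prodSub-∪ (f ∘ suc) λ j∈A → disjoint (there j∈A) ∘ there) ⟩
    fb ℕ.* prodSub (A ∪ B) (f ∘ suc) ∎
    where
    open ≡-Reasoning
    pA pB fb : ℕ
    pA = prodSub A (f ∘ suc)
    pB = prodSub B (f ∘ suc)
    fb = if b then f zero else 1

  prime∤prodSub : ∀ (f : Fin n → ℕ) {p} → Prime p → (∀ {j} → j ∈ A → ¬ p ∣ f j) → ¬ p ∣ prodSub A f
  prime∤prodSub {A = []}    f p-prime p∤ p∣ = prime∤1 p-prime p∣
  prime∤prodSub {A = outside ∷ A} f p-prime p∤ p∣ with euclidsLemma 1 _ p-prime p∣
  ... | inj₁ p∣1 = prime∤1 p-prime p∣1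
  ... | inj₂ p∣  = prime∤prodSub (f ∘ suc) p-prime (p∤ ∘ there) p∣
  prime∤prodSub {A = inside ∷ A} f p-prime p∤ p∣ with euclidsLemma (f zero) _ p-prime p∣
  ... | inj₁ p∣f = p∤ here p∣f
  ... | inj₂ p∣  = prime∤prodSub (f ∘ suc) p-prime (p∤ ∘ there) p∣

  prodSub-nonZero : ∀ (f : Fin n → ℕ) → (∀ i → ℕ.NonZero (f i)) → ℕ.NonZero (prodSub A f)
  prodSub-nonZero {A = []}          f f≢0 = _
  prodSub-nonZero {A = outside ∷ A} f f≢0 = ℕP.m*n≢0 1 _ {{_}} {{prodSub-nonZero {A = A} (f ∘ suc) (f≢0 ∘ suc)}}
  prodSub-nonZero {A = inside ∷ A}  f f≢0 = ℕP.m*n≢0 (f zero) _ {{f≢0 zero}} {{prodSub-nonZero {A = A} (f ∘ suc) (f≢0 ∘ suc)}}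

  module _ {f : Fin n → ℕ} (f-prime : ∀ i → Prime (f i)) (f-injective : Injective _≡_ _≡_ f) where

    prodSub-∉⇒∤ : ∀ {i} → i ∉ A → ¬ f i ∣ prodSub A f
    prodSub-∉⇒∤ {i = i} i∉A = prime∤prodSub f (f-prime i) λ j∈A fi∣fj →
      i∉A (subst (_∈ _) (sym (f-injective (prime∣prime⇒≡ (f-prime i) (f-prime _) fi∣fj))) j∈A)

  prodSub-∣ : ∀ {f : Fin n → ℕ} → (∀ i → Prime (f i)) → Injective _≡_ _≡_ f →
    ∀ {x} → (∀ {j} → j ∈ A → f j ∣ x) → prodSub A f ∣ x
  prodSub-∣ {A = []} _ _ _ = ℕD.1∣ _
  prodSub-∣ {A = outside ∷ A} f-prime f-inj f∣x =
    subst (_∣ _) (sym (ℕP.*-identityˡ _)) (prodSub-∣ {A = A} (f-prime ∘ suc) (FinP.suc-injective ∘ f-inj) (f∣x ∘ there))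
  prodSub-∣ {A = inside ∷ A} {f} f-prime f-inj f∣x = coprime⇒*∣
    (prime∤⇒coprime (f-prime zero) (prime∤prodSub {A = A} (f ∘ suc) (f-prime zero) λ {j} _ f₀∣f[j+1] →
      FinP.0≢1+n (f-inj (prime∣prime⇒≡ (f-prime zero) (f-prime (suc j)) f₀∣f[j+1]))))
    (f∣x here) (prodSub-∣ {A = A} (f-prime ∘ suc) (FinP.suc-injective ∘ f-inj) (f∣x ∘ there))

infix 4 _≡_mod_

record _≡_mod_ (a b : ℤ) (n : ℕ) : Set where
  constructor mod-∣
  field ∣-diff : + n ℤD.∣ a - b
open _≡_mod_

module _ {n : ℕ} where

  ≡⇒≡-mod : ∀ {a b} → a ≡ b → a ≡ b mod n
  ≡⇒≡-mod {a} refl = mod-∣ (subst (+ n ℤD.∣_) (sym (ℤP.+-inverseʳ a)) (divides 0ℤ refl))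

  ≡-mod-sym : ∀ {a b} → a ≡ b mod n → b ≡ a mod n
  ≡-mod-sym {a} {b} (mod-∣ n∣a-b) = mod-∣ (subst (+ n ℤD.∣_)
    (solve 2 (λ a b → :- (a :- b) := b :- a) refl a b) (ℤD.∣m⇒∣-m n∣a-b))

  ≡-mod-trans : ∀ {a b c} → a ≡ b mod n → b ≡ c mod n → a ≡ c mod n
  ≡-mod-trans {a} {b} {c} (mod-∣ n∣a-b) (mod-∣ n∣b-c) = mod-∣ (subst (+ n ℤD.∣_)
    (solve 3 (λ a b c → (a :- b) :+ (b :- c) := a :- c) refl a b c) (ℤD.∣m∣n⇒∣m+n n∣a-b n∣b-c))

  ≡-mod-*ˡ : ∀ c {a b} → a ≡ b mod n → c * a ≡ c * b mod n
  ≡-mod-*ˡ c {a} {b} (mod-∣ n∣a-b) = mod-∣ (subst (+ n ℤD.∣_)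
    (solve 3 (λ c a b → c :* (a :- b) := c :* a :- c :* b) refl c a b) (ℤD.∣n⇒∣m*n c n∣a-b))

  ≡-mod-∣ : ∀ {a b} → a ≡ b mod n → + n ℤD.∣ a → + n ℤD.∣ b
  ≡-mod-∣ {a} {b} (mod-∣ n∣a-b) n∣a = subst (+ n ℤD.∣_)
    (solve 2 (λ a b → a :- (a :- b) := b) refl a b) (ℤD.∣m∣n⇒∣m-n n∣a n∣a-b)

  ≡-mod-dec : ∀ a b → Dec (a ≡ b mod n)
  ≡-mod-dec a b = map′ mod-∣ ∣-diff (+ n ℤD.∣? (a - b))

≡-mod-setoid : ℕ → Setoid _ _
≡-mod-setoid n = record
  { Carrier       = ℤ
  ; _≈_           = λ a b → a ≡ b mod n
  ; isEquivalence = record { refl = ≡⇒≡-mod refl ; sym = ≡-mod-sym ; trans = ≡-mod-trans }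
  }

module ≡-mod-Reasoning (n : ℕ) = Relation.Binary.Reasoning.Setoid (≡-mod-setoid n)

≡-mod-weaken : ∀ {d n a b} → d ∣ n → a ≡ b mod n → a ≡ b mod d
≡-mod-weaken d∣n (mod-∣ n∣a-b) = mod-∣ (ℤD.∣-trans (ℤD.∣ᵤ⇒∣ d∣n) n∣a-b)

prime∣*⇒∣ : ∀ {p c} a → Prime p → ¬ p ∣ c → + p ℤD.∣ + c * a → + p ℤD.∣ a
prime∣*⇒∣ {p} {c} a p-prime p∤c p∣ca
  with euclidsLemma c ℤ.∣ a ∣ p-prime (subst (p ∣_) (ℤP.abs-* (+ c) a) (ℤD.∣⇒∣ᵤ p∣ca))
... | inj₁ p∣c = contradiction p∣c p∤c
... | inj₂ p∣a = ℤD.∣ᵤ⇒∣ p∣a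

≡-mod-cancel-prime : ∀ {p c a b} → Prime p → ¬ p ∣ c → + c * a ≡ + c * b mod p → a ≡ b mod p
≡-mod-cancel-prime {p} {c} {a} {b} p-prime p∤c (mod-∣ p∣ca-cb) = mod-∣ (prime∣*⇒∣ (a - b) p-prime p∤c
  (subst (+ p ℤD.∣_) (solve 3 (λ c a b → c :* a :- c :* b := c :* (a :- b)) refl (+ c) a b) p∣ca-cb))

≡-mod-crt : ∀ {m n a b} → Coprime m n → a ≡ b mod m → a ≡ b mod n → a ≡ b mod (m ℕ.* n)
≡-mod-crt coprime (mod-∣ m∣a-b) (mod-∣ n∣a-b) =
  mod-∣ (ℤD.∣ᵤ⇒∣ (coprime⇒*∣ coprime (ℤD.∣⇒∣ᵤ m∣a-b) (ℤD.∣⇒∣ᵤ n∣a-b)))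

≡-mod-cancel : ∀ {c q a b} .{{_ : ℕ.NonZero c}} → + c * a ≡ + c * b mod (c ℕ.* q) → a ≡ b mod q
≡-mod-cancel {c} {q} {a} {b} (mod-∣ cq∣ca-cb) =
  mod-∣ (ℤD.∣ᵤ⇒∣ (ℕD.*-cancelˡ-∣ c (subst (c ℕ.* q ∣_) ∣ca-cb∣≡c*∣a-b∣ (ℤD.∣⇒∣ᵤ cq∣ca-cb))))
  where
  ∣ca-cb∣≡c*∣a-b∣ : ℤ.∣ + c * a - + c * b ∣ ≡ c ℕ.* ℤ.∣ a - b ∣
  ∣ca-cb∣≡c*∣a-b∣ = trans (cong ℤ.∣_∣ (sym (*-distribˡ-- (+ c) a b))) (ℤP.abs-* (+ c) (a - b))

inverse-mod : ∀ {a b} → Coprime a b → ∃ λ u → u * + b ≡ 1ℤ mod a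
inverse-mod {a} {b} coprime with coprime-Bézout coprime
... | Bézout.+- x y eq = - + y , mod-∣ (divides (- + x) (begin
  - + y * + b - 1ℤ    ≡⟨ solve 2 (λ y b → :- y :* b :- con 1ℤ := :- (con 1ℤ :+ y :* b)) refl (+ y) (+ b) ⟩
  - (1ℤ + + y * + b)  ≡⟨ cong (λ z → - (1ℤ + z)) (ℤP.pos-* y b) ⟨
  - + (1 ℕ.+ y ℕ.* b) ≡⟨ cong (-_ ∘ +_) eq ⟩
  - + (x ℕ.* a)       ≡⟨ cong -_ (ℤP.pos-* x a) ⟩
  - (+ x * + a)       ≡⟨ ℤP.neg-distribˡ-* (+ x) (+ a) ⟩
  - + x * + a         ∎))
  where open ≡-Reasoning
... | Bézout.-+ x y eq = + y , mod-∣ (divides (+ x) (begin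
  + y * + b - 1ℤ             ≡⟨ cong (_- 1ℤ) (ℤP.pos-* y b) ⟨
  + (y ℕ.* b) - 1ℤ           ≡⟨ cong (λ z → + z - 1ℤ) eq ⟨
  + (1 ℕ.+ x ℕ.* a) - 1ℤ     ≡⟨ cong (_- 1ℤ) (ℤP.pos-+ 1 (x ℕ.* a)) ⟩
  1ℤ + + (x ℕ.* a) - 1ℤ      ≡⟨ solve 1 (λ z → con 1ℤ :+ z :- con 1ℤ := z) refl (+ (x ℕ.* a)) ⟩
  + (x ℕ.* a)                ≡⟨ ℤP.pos-* x a ⟩
  + x * + a                  ∎))
  where open ≡-Reasoning

∣∧<⇒≡0 : ∀ {d n} → d ∣ n → n ℕ.< d → n ≡ 0
∣∧<⇒≡0 {n = zero}  _   _   = refl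
∣∧<⇒≡0 {n = suc n} d∣n n<d = contradiction d∣n (ℕD.>⇒∤ n<d)

≡-mod-<⇒≡ : ∀ {n a b} → a ℕ.< n → b ℕ.< n → + a ≡ + b mod n → a ≡ b
≡-mod-<⇒≡ {n} {a} {b} a<n b<n (mod-∣ n∣a-b) = ℤP.+-injective (ℤP.i-j≡0⇒i≡j (+ a) (+ b) (ℤP.∣i∣≡0⇒i≡0
  (∣∧<⇒≡0 (ℤD.∣⇒∣ᵤ n∣a-b) (ℕP.≤-<-trans ∣a-b∣≤a⊔b (ℕP.⊔-lub a<n b<n)))))
  where
  ∣a-b∣≤a⊔b : ℤ.∣ + a - + b ∣ ℕ.≤ a ℕ.⊔ b
  ∣a-b∣≤a⊔b = subst (ℕ._≤ a ℕ.⊔ b) (cong ℤ.∣_∣ (sym (ℤP.m-n≡m⊖n a b))) (ℤP.∣m⊝n∣≤m⊔n a b)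

module Resolution (k : ℕ) (ℓ : Fin k → ℕ)
  (ℓ-prime : ∀ i → Prime (ℓ i)) (ℓ-injective : Injective _≡_ _≡_ ℓ) where

  open Setup k ℓ

  ⟪_⟫ : Num → ℤ
  ⟪ y ⟫ = + toℕ y

  instance
    r-nonZero : ℕ.NonZero r
    r-nonZero = prodSub-nonZero {A = ⊤} ℓ (prime⇒nonZero ∘ ℓ-prime)

  ℓ∣r : ∀ i → ℓ i ∣ r
  ℓ∣r i = prodSub-∈ ℓ SubP.∈⊤

  reduce : ℤ → Num
  reduce a = fromℕ< (ℤ.n%ℕd<d a r)

  reduce-≡ : ∀ a → ⟪ reduce a ⟫ ≡ a mod r
  reduce-≡ a = mod-∣ (divides (- (a ℤ./ℕ r)) (begin
    ⟪ reduce a ⟫ - a                                       ≡⟨ cong (λ z → + z - a) (FinP.toℕ-fromℕ< (ℤ.n%ℕd<d a r)) ⟩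
    + (a ℤ.%ℕ r) - a                                       ≡⟨ cong (_-_ (+ (a ℤ.%ℕ r))) (ℤ.a≡a%ℕn+[a/ℕn]*n a r) ⟩
    + (a ℤ.%ℕ r) - (+ (a ℤ.%ℕ r) + (a ℤ./ℕ r) * + r)
      ≡⟨ solve 3 (λ x q r → x :- (x :+ q :* r) := (:- q) :* r) refl (+ (a ℤ.%ℕ r)) (a ℤ./ℕ r) (+ r) ⟩
    - (a ℤ./ℕ r) * + r                                     ∎))
    where open ≡-Reasoning

  ⟪⟫-injective-mod : ∀ {x y} → ⟪ x ⟫ ≡ ⟪ y ⟫ mod r → x ≡ y
  ⟪⟫-injective-mod {x} {y} x≡y = FinP.toℕ-injective (≡-mod-<⇒≡ (FinP.toℕ<n x) (FinP.toℕ<n y) x≡y)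

  infix 8 ℓ[_]*_
  ℓ[_]*_ : Fin k → Num → Num
  ℓ[ i ]* y = reduce (+ (ℓ i ℕ.* toℕ y))

  ℓ[]*-≡ : ∀ i y → ⟪ ℓ[ i ]* y ⟫ ≡ + ℓ i * ⟪ y ⟫ mod r
  ℓ[]*-≡ i y = ≡-mod-trans (reduce-≡ _) (≡⇒≡-mod (ℤP.pos-* (ℓ i) (toℕ y)))

  ℓ[]*-unique : ∀ {i y x} → ⟪ x ⟫ ≡ + ℓ i * ⟪ y ⟫ mod r → x ≡ ℓ[ i ]* y
  ℓ[]*-unique {i} {y} x≡ = ⟪⟫-injective-mod (≡-mod-trans x≡ (≡-mod-sym (ℓ[]*-≡ i y)))

  ℓ[]*-comm : ∀ i j y → ℓ[ i ]* ℓ[ j ]* y ≡ ℓ[ j ]* ℓ[ i ]* y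
  ℓ[]*-comm i j y = ℓ[]*-unique (begin
    ⟪ ℓ[ i ]* ℓ[ j ]* y ⟫        ≈⟨ ℓ[]*-≡ i (ℓ[ j ]* y) ⟩
    + ℓ i * ⟪ ℓ[ j ]* y ⟫        ≈⟨ ≡-mod-*ˡ (+ ℓ i) (ℓ[]*-≡ j y) ⟩
    + ℓ i * (+ ℓ j * ⟪ y ⟫)      ≡⟨ solve 3 (λ a b c → a :* (b :* c) := b :* (a :* c)) refl (+ ℓ i) (+ ℓ j) ⟪ y ⟫ ⟩
    + ℓ j * (+ ℓ i * ⟪ y ⟫)      ≈⟨ ≡-mod-*ˡ (+ ℓ j) (ℓ[]*-≡ i y) ⟨
    + ℓ j * ⟪ ℓ[ i ]* y ⟫        ∎)
    where open ≡-mod-Reasoning r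

  infix 4 ℓ[_]∣_
  ℓ[_]∣_ : Fin k → Num → Set
  ℓ[ j ]∣ y = ℓ j ∣ toℕ y

  ℓ[_]∣?_ : ∀ j y → Dec (ℓ[ j ]∣ y)
  ℓ[ j ]∣? y = ℓ j ∣? toℕ y

  ℓ∤ℓ : ∀ {i j} → ¬ i ≡ j → ¬ ℓ j ∣ ℓ i
  ℓ∤ℓ i≢j ℓj∣ℓi = i≢j (sym (ℓ-injective (prime∣prime⇒≡ (ℓ-prime _) (ℓ-prime _) ℓj∣ℓi)))

  ℓ[]*-≡[ℓ] : ∀ i j y → ⟪ ℓ[ i ]* y ⟫ ≡ + ℓ i * ⟪ y ⟫ mod ℓ j
  ℓ[]*-≡[ℓ] i j y = ≡-mod-weaken (ℓ∣r j) (ℓ[]*-≡ i y)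

  ∣-ℓ[]*⁺ : ∀ i {j y} → ℓ[ j ]∣ y → ℓ[ j ]∣ ℓ[ i ]* y
  ∣-ℓ[]*⁺ i {j} {y} ℓj∣y =
    ℤD.∣⇒∣ᵤ (≡-mod-∣ (≡-mod-sym (ℓ[]*-≡[ℓ] i j y)) (ℤD.∣n⇒∣m*n (+ ℓ i) (ℤD.∣ᵤ⇒∣ ℓj∣y)))

  ∣-ℓ[]*⁻ : ∀ {i j y} → ¬ i ≡ j → ℓ[ j ]∣ ℓ[ i ]* y → ℓ[ j ]∣ y
  ∣-ℓ[]*⁻ {i} {j} {y} i≢j ℓj∣ℓiy = ℤD.∣⇒∣ᵤ
    (prime∣*⇒∣ ⟪ y ⟫ (ℓ-prime j) (ℓ∤ℓ i≢j) (≡-mod-∣ (ℓ[]*-≡[ℓ] i j y) (ℤD.∣ᵤ⇒∣ ℓj∣ℓiy)))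

  ∣-ℓ[]*-self : ∀ i y → ℓ[ i ]∣ ℓ[ i ]* y
  ∣-ℓ[]*-self i y = ℤD.∣⇒∣ᵤ (≡-mod-∣ (≡-mod-sym (ℓ[]*-≡[ℓ] i i y)) (ℤD.∣m⇒∣m*n ⟪ y ⟫ ℤD.∣-refl))

  cofactor : Fin k → ℕ
  cofactor m = rT (⊤ ∖ m)

  r≡ℓ*cofactor : ∀ m → r ≡ ℓ m ℕ.* cofactor m
  r≡ℓ*cofactor m = trans (cong rT (sym (x∈p⇒p∖x∪⁅x⁆≡p SubP.∈⊤))) (prodSub-∪⁅⁆ ℓ (x∉p∖x ⊤ m))

  ℓ-coprime-cofactor : ∀ m → Coprime (ℓ m) (cofactor m)
  ℓ-coprime-cofactor m = prime∤⇒coprime (ℓ-prime m) (prodSub-∉⇒∤ ℓ-prime ℓ-injective (x∉p∖x ⊤ m))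

  root : ∀ m (t : ℤ) {w} → ℓ[ m ]∣ w → ∃ λ y → (ℓ[ m ]* y ≡ w) × (⟪ y ⟫ ≡ t mod ℓ m)
  root m t {w} (ℕD.divides w′ w≡w′ℓ) =
    reduce y₀ , sym (ℓ[]*-unique w≡ℓy) , ≡-mod-trans (≡-mod-weaken (ℓ∣r m) (reduce-≡ y₀)) y₀≡t
    where
    inv : ℤ
    inv = proj₁ (inverse-mod (ℓ-coprime-cofactor m))
    c : ℤ
    c = inv * (t - + w′)
    y₀ : ℤ
    y₀ = + w′ + + cofactor m * c
    ⟪w⟫≡ : ⟪ w ⟫ ≡ + w′ * + ℓ m
    ⟪w⟫≡ = trans (cong +_ w≡w′ℓ) (ℤP.pos-* w′ (ℓ m))
    +r≡ : + r ≡ + ℓ m * + cofactor m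
    +r≡ = trans (cong +_ (r≡ℓ*cofactor m)) (ℤP.pos-* (ℓ m) (cofactor m))
    w≡ℓy₀ : ⟪ w ⟫ ≡ + ℓ m * y₀ mod r
    w≡ℓy₀ = mod-∣ (divides (- c) (begin
      ⟪ w ⟫ - + ℓ m * y₀               ≡⟨ cong (_- + ℓ m * y₀) ⟪w⟫≡ ⟩
      + w′ * + ℓ m - + ℓ m * y₀
        ≡⟨ solve 4 (λ w l q c → w :* l :- l :* (w :+ q :* c) := (:- c) :* (l :* q)) refl (+ w′) (+ ℓ m) (+ cofactor m) c ⟩
      - c * (+ ℓ m * + cofactor m)     ≡⟨ cong (- c *_) +r≡ ⟨
      - c * + r                        ∎))
      where open ≡-Reasoning
    w≡ℓy : ⟪ w ⟫ ≡ + ℓ m * ⟪ reduce y₀ ⟫ mod r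
    w≡ℓy = ≡-mod-trans w≡ℓy₀ (≡-mod-*ˡ (+ ℓ m) (≡-mod-sym (reduce-≡ y₀)))
    y₀≡t : y₀ ≡ t mod ℓ m
    y₀≡t = mod-∣ (subst (+ ℓ m ℤD.∣_)
      (solve 4 (λ t w u q → (t :- w) :* (u :* q :- con 1ℤ) := (w :+ q :* (u :* (t :- w))) :- t) refl t (+ w′) inv (+ cofactor m))
      (ℤD.∣n⇒∣m*n (t - + w′) (∣-diff (proj₂ (inverse-mod (ℓ-coprime-cofactor m))))))

  root-unique : ∀ m {y y′} → ℓ[ m ]* y ≡ ℓ[ m ]* y′ → ⟪ y ⟫ ≡ ⟪ y′ ⟫ mod ℓ m → y ≡ y′
  root-unique m {y} {y′} ℓy≡ℓy′ y≡y′[ℓ] = ⟪⟫-injective-mod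
    (subst (⟪ y ⟫ ≡ ⟪ y′ ⟫ mod_) (sym (r≡ℓ*cofactor m)) (≡-mod-crt (ℓ-coprime-cofactor m) y≡y′[ℓ] y≡y′[cofactor]))
    where
    instance
      ℓ-nonZero : ℕ.NonZero (ℓ m)
      ℓ-nonZero = prime⇒nonZero (ℓ-prime m)
    ℓy≡ℓy′[r] : + ℓ m * ⟪ y ⟫ ≡ + ℓ m * ⟪ y′ ⟫ mod r
    ℓy≡ℓy′[r] =
      ≡-mod-trans (≡-mod-sym (ℓ[]*-≡ m y)) (subst (λ x → ⟪ x ⟫ ≡ _ mod r) (sym ℓy≡ℓy′) (ℓ[]*-≡ m y′))
    y≡y′[cofactor] : ⟪ y ⟫ ≡ ⟪ y′ ⟫ mod cofactor m
    y≡y′[cofactor] = ≡-mod-cancel (subst (+ ℓ m * ⟪ y ⟫ ≡ + ℓ m * ⟪ y′ ⟫ mod_) (r≡ℓ*cofactor m) ℓy≡ℓy′[r])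

  ε : Fin k → Fin k → ℤ
  ε m i = if ⌊ m <? i ⌋ then -1ℤ else 1ℤ

  ε-anti : ∀ {m i} → ¬ m ≡ i → ε m i ≡ - ε i m
  ε-anti {m} {i} m≢i with m <? i | i <? m
  ... | yes m<i | yes i<m = contradiction i<m (FinP.<-asym m<i)
  ... | yes _   | no _    = refl
  ... | no _    | yes _   = refl
  ... | no m≮i  | no i≮m  = contradiction (FinP.≤-antisym (ℕP.≮⇒≥ i≮m) (ℕP.≮⇒≥ m≮i)) m≢i

  ε*ε≡1 : ∀ m i → ε m i * ε m i ≡ 1ℤ
  ε*ε≡1 m i with m <? i
  ... | yes _ = refl
  ... | no _  = refl

  ω*ω≡1 : ∀ i T → ω i T * ω i T ≡ 1ℤ
  ω*ω≡1 i T = sgn*sgn (∣ T ∩ below i ∣)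
    where
    sgn*sgn : ∀ n → sgn n * sgn n ≡ 1ℤ
    sgn*sgn zero    = refl
    sgn*sgn (suc n) = trans (solve 1 (λ s → (:- s) :* (:- s) := s :* s) refl (sgn n)) (sgn*sgn n)

  ∈-below⁺ : ∀ {i j} → j < i → j ∈ below i
  ∈-below⁺ {i} = ∈-subsetOf⁺ (_<? i)

  ∈-below⁻ : ∀ {i j} → j ∈ below i → j < i
  ∈-below⁻ {i} = ∈-subsetOf⁻ (_<? i)

  ω-∪⁅⁆-≮ : ∀ {m i} V → ¬ m < i → ω i (V ∪ ⁅ m ⁆) ≡ ω i V
  ω-∪⁅⁆-≮ V m≮i = cong (sgn ∘ ∣_∣) (x∉q⇒p∪⁅x⁆∩q≡p∩q V (m≮i ∘ ∈-below⁻))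

  ω-∪⁅⁆-< : ∀ {m i V} → m < i → m ∉ V → ω i (V ∪ ⁅ m ⁆) ≡ - ω i V
  ω-∪⁅⁆-< {V = V} m<i m∉V = cong sgn (trans (cong ∣_∣ (x∈q⇒p∪⁅x⁆∩q≡p∩q∪⁅x⁆ V (∈-below⁺ m<i)))
    (x∉p⇒∣p∪⁅x⁆∣≡1+∣p∣ (m∉V ∘ proj₁ ∘ SubP.x∈p∩q⁻ V _)))

  ω-∪⁅⁆ : ∀ {m i V} → m ∉ V → ω i (V ∪ ⁅ m ⁆) ≡ ε m i * ω i V
  ω-∪⁅⁆ {m} {i} {V} m∉V with m <? i
  ... | yes m<i = trans (ω-∪⁅⁆-< m<i m∉V) (sym (ℤP.-1*i≡-i (ω i V)))
  ... | no m≮i  = trans (ω-∪⁅⁆-≮ V m≮i) (sym (ℤP.*-identityˡ (ω i V)))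

  ω-∪⁅self⁆ : ∀ i V → ω i (V ∪ ⁅ i ⁆) ≡ ω i V
  ω-∪⁅self⁆ i V = ω-∪⁅⁆-≮ V (FinP.<-irrefl refl)

  koszul-sign : ∀ {i j T} → i ∉ T → j ∉ T → ¬ i ≡ j → ∀ Φ →
    ω i T * (ω j (T ∪ ⁅ i ⁆) * Φ) ≡ - (ω j T * (ω i (T ∪ ⁅ j ⁆) * Φ))
  koszul-sign {i} {j} {T} i∉T j∉T i≢j Φ = begin
    ω i T * (ω j (T ∪ ⁅ i ⁆) * Φ)         ≡⟨ cong (λ w → ω i T * (w * Φ)) (ω-∪⁅⁆ i∉T) ⟩
    ω i T * (ε i j * ω j T * Φ)
      ≡⟨ solve 4 (λ a e b f → a :* (e :* b :* f) := :- (b :* ((:- e) :* a :* f))) refl (ω i T) (ε i j) (ω j T) Φ ⟩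
    - (ω j T * (- ε i j * ω i T * Φ))     ≡⟨ cong (λ e → - (ω j T * (e * ω i T * Φ))) (ε-anti (i≢j ∘ sym)) ⟨
    - (ω j T * (ε j i * ω i T * Φ))       ≡⟨ cong (λ w → - (ω j T * (w * Φ))) (ω-∪⁅⁆ j∉T) ⟨
    - (ω j T * (ω i (T ∪ ⁅ j ⁆) * Φ))     ∎
    where open ≡-Reasoning

  infixl 6 _⊕_ _⊖_
  _⊕_ _⊖_ : Chain → Chain → Chain
  (a ⊕ b) T x = a T x + b T x
  (a ⊖ b) T x = a T x - b T x

  SupportedOn : (Subset k → Num → Set) → Chain → Set
  SupportedOn P c = ∀ T y → ¬ c T y ≡ 0ℤ → P T y

  module _ {P : Subset k → Num → Set} where

    vanishes-off : ∀ {c T y} → SupportedOn P c → ¬ P T y → c T y ≡ 0ℤ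
    vanishes-off {c} {T} {y} supp ¬P = ≡0-stable (c T y) (¬P ∘ supp T y)

    supported-0 : SupportedOn P zeroC
    supported-0 T y 0≢0 = contradiction refl 0≢0

    supported-⊕ : ∀ {a b} → SupportedOn P a → SupportedOn P b → SupportedOn P (a ⊕ b)
    supported-⊕ {a} {b} supp-a supp-b T y ≢0 with ≢0-+ (a T y) (b T y) ≢0
    ... | inj₁ a≢0 = supp-a T y a≢0
    ... | inj₂ b≢0 = supp-b T y b≢0

    supported-⊖ : ∀ {a b} → SupportedOn P a → SupportedOn P b → SupportedOn P (a ⊖ b)
    supported-⊖ {a} {b} supp-a supp-b T y ≢0 with ≢0-- (a T y) (b T y) ≢0
    ... | inj₁ a≢0 = supp-a T y a≢0
    ... | inj₂ b≢0 = supp-b T y b≢0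

  Homog⇒supported : ∀ {n c} → Homog n c → SupportedOn (λ T _ → ∣ T ∣ ≡ n) c
  Homog⇒supported {n} hom T y c≢0 = decidable-stable (∣ T ∣ ℕP.≟ n) (c≢0 ∘ hom T y)

  supported⇒Homog : ∀ {n c} → SupportedOn (λ T _ → ∣ T ∣ ≡ n) c → Homog n c
  supported⇒Homog supp T y = vanishes-off supp

  Homog-⊕ : ∀ {n a b} → Homog n a → Homog n b → Homog n (a ⊕ b)
  Homog-⊕ hom-a hom-b T x ∣T∣≢n = cong₂ _+_ (hom-a T x ∣T∣≢n) (hom-b T x ∣T∣≢n)

  Homog-⊖ : ∀ {n a b} → Homog n a → Homog n b → Homog n (a ⊖ b)
  Homog-⊖ hom-a hom-b T x ∣T∣≢n = cong₂ _-_ (hom-a T x ∣T∣≢n) (hom-b T x ∣T∣≢n)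

  ∂-term : Chain → Subset k → Num → Fin k → ℤ
  ∂-term c T y i = unless (i ∈? T) (ω i T * (c (T ∪ ⁅ i ⁆) y - c (T ∪ ⁅ i ⁆) (ℓ[ i ]* y)))

  ∂ : Chain → Chain
  ∂ c T y = sumFin k (∂-term c T y)

  ∑-rel : ∀ (C : Num → ℤ) i y → sumFin r (λ x → C x * rel i x y) ≡ C y - C (ℓ[ i ]* y)
  ∑-rel C i y = begin
    sumFin r (λ x → C x * rel i x y)                                               ≡⟨ sumFin-cong r (λ x → *-distribˡ-- (C x) _ _) ⟩
    sumFin r (λ x → C x * ind (y FinP.≟ x) - C x * ind (MulEq i y x))              ≡⟨ sumFin-- r _ _ ⟩
    sumFin r (λ x → C x * ind (y FinP.≟ x)) - sumFin r (λ x → C x * ind (MulEq i y x))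
      ≡⟨ cong₂ _-_ (sumFin-ind r C (y FinP.≟_) y refl sym)
                   (sumFin-ind r C (MulEq i y) (ℓ[ i ]* y) (∣-diff (≡-mod-sym (reduce-≡ (+ (ℓ i ℕ.* toℕ y)))))
                               (ℓ[]*-unique ∘ root-of)) ⟩
    C y - C (ℓ[ i ]* y)                                                             ∎
    where
    open ≡-Reasoning
    root-of : ∀ {x} → + r ℤD.∣ + (ℓ i ℕ.* toℕ y) - ⟪ x ⟫ → ⟪ x ⟫ ≡ + ℓ i * ⟪ y ⟫ mod r
    root-of r∣ = ≡-mod-sym (≡-mod-trans (≡⇒≡-mod (sym (ℤP.pos-* (ℓ i) (toℕ y)))) (mod-∣ r∣))

  dd≈∂ : ∀ c → dd c ≈C ∂ c
  dd≈∂ c T′ y = begin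
    sumSub k (λ T → sumFin r (λ x → c T x * sumFin k (λ i → ind (i ∈? T) * (ω i T * (ind (T′ ≟S (T ∖ i)) * rel i x y)))))
      ≡⟨ sumSub-cong k (λ T → sumFin-cong r (λ x → sym (sumFin-*ˡ k (c T x) _))) ⟩
    sumSub k (λ T → sumFin r (λ x → sumFin k (λ i → c T x * (ind (i ∈? T) * (ω i T * (ind (T′ ≟S (T ∖ i)) * rel i x y))))))
      ≡⟨ sumSub-cong k (λ T → sumFin-comm r k _) ⟩
    sumSub k (λ T → sumFin k (λ i → sumFin r (λ x → c T x * (ind (i ∈? T) * (ω i T * (ind (T′ ≟S (T ∖ i)) * rel i x y))))))
      ≡⟨ sumSub-cong k (λ T → sumFin-cong k (coefficient T)) ⟩
    sumSub k (λ T → sumFin k (λ i → guard T i * D T i))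
      ≡⟨ sumSub-sumFin k k _ ⟩
    sumFin k (λ i → sumSub k (λ T → guard T i * D T i))
      ≡⟨ sumFin-cong k collapse ⟩
    sumFin k (∂-term c T′ y)
      ∎
    where
    open ≡-Reasoning
    guard : Subset k → Fin k → ℤ
    guard T i = ind (i ∈? T) * (ω i T * ind (T′ ≟S (T ∖ i)))
    D : Subset k → Fin k → ℤ
    D T i = c T y - c T (ℓ[ i ]* y)
    coefficient : ∀ T i →
      sumFin r (λ x → c T x * (ind (i ∈? T) * (ω i T * (ind (T′ ≟S (T ∖ i)) * rel i x y)))) ≡ guard T i * D T i
    coefficient T i = trans
      (sumFin-cong r λ x → solve 5 (λ c a w b R → c :* (a :* (w :* (b :* R))) := (a :* (w :* b)) :* (c :* R)) refl
        (c T x) (ind (i ∈? T)) (ω i T) (ind (T′ ≟S (T ∖ i))) (rel i x y))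
      (trans (sumFin-*ˡ r (guard T i) _) (cong (guard T i *_) (∑-rel (c T) i y)))
    off : ∀ i T → ¬ T ≡ T′ ∪ ⁅ i ⁆ → guard T i * D T i ≡ 0ℤ
    off i T T≢ with i ∈? T | T′ ≟S (T ∖ i)
    ... | no _    | _        = refl
    ... | yes i∈T | yes refl = contradiction (sym (x∈p⇒p∖x∪⁅x⁆≡p i∈T)) T≢
    ... | yes _   | no _     = cong (λ g → 1ℤ * g * D T i) (ℤP.*-zeroʳ (ω i T)) 
    at : ∀ i → guard (T′ ∪ ⁅ i ⁆) i * D (T′ ∪ ⁅ i ⁆) i ≡ ∂-term c T′ y i
    at i with i ∈? T′ | i ∈? (T′ ∪ ⁅ i ⁆) | T′ ≟S ((T′ ∪ ⁅ i ⁆) ∖ i)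
    ... | _       | no i∉     | _      = contradiction (x∈p∪⁅x⁆ i) i∉
    ... | yes i∈T′ | yes _    | yes T′≡ = contradiction (subst (i ∈_) T′≡ i∈T′) (x∉p∖x _ i)
    ... | yes _   | yes _     | no _   = cong (λ g → 1ℤ * g * D (T′ ∪ ⁅ i ⁆) i) (ℤP.*-zeroʳ (ω i (T′ ∪ ⁅ i ⁆)))
    ... | no i∉T′ | yes _     | no T′≢ = contradiction (sym (x∉p⇒p∪⁅x⁆∖x≡p i∉T′)) T′≢
    ... | no _    | yes _     | yes _  = cong (_* D (T′ ∪ ⁅ i ⁆) i)
      (trans (ℤP.*-identityˡ _) (trans (ℤP.*-identityʳ _) (ω-∪⁅self⁆ i T′)))
    collapse : ∀ i → sumSub k (λ T → guard T i * D T i) ≡ ∂-term c T′ y i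
    collapse i = trans (sumSub-single k (T′ ∪ ⁅ i ⁆) (off i)) (at i)

  ∂-⊕ : ∀ a b → ∂ (a ⊕ b) ≈C (∂ a ⊕ ∂ b)
  ∂-⊕ a b T y = trans (sumFin-cong k term) (sumFin-+ k _ _)
    where
    term : ∀ i → ∂-term (a ⊕ b) T y i ≡ ∂-term a T y i + ∂-term b T y i
    term i with i ∈? T
    ... | yes _ = refl
    ... | no _  = solve 5 (λ w p q s t → w :* ((p :+ q) :- (s :+ t)) := w :* (p :- s) :+ w :* (q :- t)) refl
      (ω i T) (a (T ∪ ⁅ i ⁆) y) (b (T ∪ ⁅ i ⁆) y) (a (T ∪ ⁅ i ⁆) (ℓ[ i ]* y)) (b (T ∪ ⁅ i ⁆) (ℓ[ i ]* y))

  ∂-⊖ : ∀ a b → ∂ (a ⊖ b) ≈C (∂ a ⊖ ∂ b)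
  ∂-⊖ a b T y = trans (sumFin-cong k term) (sumFin-- k _ _)
    where
    term : ∀ i → ∂-term (a ⊖ b) T y i ≡ ∂-term a T y i - ∂-term b T y i
    term i with i ∈? T
    ... | yes _ = refl
    ... | no _  = solve 5 (λ w p q s t → w :* ((p :- q) :- (s :- t)) := w :* (p :- s) :- w :* (q :- t)) refl
      (ω i T) (a (T ∪ ⁅ i ⁆) y) (b (T ∪ ⁅ i ⁆) y) (a (T ∪ ⁅ i ⁆) (ℓ[ i ]* y)) (b (T ∪ ⁅ i ⁆) (ℓ[ i ]* y))

  ∂-0 : ∀ T y → ∂ zeroC T y ≡ 0ℤ
  ∂-0 T y = sumFin-0 k λ i → trans (cong (unless (i ∈? T)) (ℤP.*-zeroʳ (ω i T))) (unless-0 (i ∈? T))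

  ∂-≢0 : ∀ c T y → ¬ ∂ c T y ≡ 0ℤ →
    ∃ λ i → i ∉ T × (¬ c (T ∪ ⁅ i ⁆) y ≡ 0ℤ ⊎ ¬ c (T ∪ ⁅ i ⁆) (ℓ[ i ]* y) ≡ 0ℤ)
  ∂-≢0 c T y ∂≢0 with sumFin-≢0 k (∂-term c T y) ∂≢0
  ... | i , term≢0 with unless-≢0 (i ∈? T) term≢0
  ...   | i∉T , ≢0 = i , i∉T , ≢0-- _ _ (≢0-*ʳ (ω i T) _ ≢0)

  ∂-Homog : ∀ {n c} → Homog (suc n) c → Homog n (∂ c)
  ∂-Homog {n} {c} hom = supported⇒Homog λ T y ∂≢0 → ℕP.suc-injective (lemma T y (∂-≢0 c T y ∂≢0))
    where
    lemma : ∀ T y → ∃ (λ i → i ∉ T × (¬ c (T ∪ ⁅ i ⁆) y ≡ 0ℤ ⊎ ¬ c (T ∪ ⁅ i ⁆) (ℓ[ i ]* y) ≡ 0ℤ)) →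
      suc ∣ T ∣ ≡ suc n
    lemma T y (i , i∉T , c≢0) = trans (sym (x∉p⇒∣p∪⁅x⁆∣≡1+∣p∣ i∉T))
      ([ Homog⇒supported hom (T ∪ ⁅ i ⁆) y , Homog⇒supported hom (T ∪ ⁅ i ⁆) (ℓ[ i ]* y) ]′ c≢0)

  ∂∂≡0 : ∀ c T y → ∂ (∂ c) T y ≡ 0ℤ
  ∂∂≡0 c T y = trans (sumFin-cong k expand) (sumFin-antisym k F (antisym-by-cases (_∈? T) F zeroˡ zeroʳ diagonal generic))
    where
    F : Fin k → Fin k → ℤ
    F i j = unless (i ∈? T) (ω i T * (∂-term c (T ∪ ⁅ i ⁆) y j - ∂-term c (T ∪ ⁅ i ⁆) (ℓ[ i ]* y) j))
    expand : ∀ i → ∂-term (∂ c) T y i ≡ sumFin k (F i)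
    expand i = begin
      unless (i ∈? T) (ω i T * (∂ c (T ∪ ⁅ i ⁆) y - ∂ c (T ∪ ⁅ i ⁆) (ℓ[ i ]* y)))
        ≡⟨ cong (λ z → unless (i ∈? T) (ω i T * z)) (sumFin-- k _ _) ⟨
      unless (i ∈? T) (ω i T * sumFin k (λ j → ∂-term c (T ∪ ⁅ i ⁆) y j - ∂-term c (T ∪ ⁅ i ⁆) (ℓ[ i ]* y) j))
        ≡⟨ cong (unless (i ∈? T)) (sumFin-*ˡ k (ω i T) _) ⟨
      unless (i ∈? T) (sumFin k (λ j → ω i T * (∂-term c (T ∪ ⁅ i ⁆) y j - ∂-term c (T ∪ ⁅ i ⁆) (ℓ[ i ]* y) j)))
        ≡⟨ unless-sumFin (i ∈? T) k _ ⟩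
      sumFin k (F i) ∎
      where open ≡-Reasoning
    inner-zero : ∀ {i j} → j ∈ T ∪ ⁅ i ⁆ → F i j ≡ 0ℤ
    inner-zero {i} j∈ = trans
      (cong (λ z → unless (i ∈? T) (ω i T * z)) (cong₂ _-_ (unless-yes (_ ∈? _) j∈) (unless-yes (_ ∈? _) j∈)))
      (trans (cong (unless (i ∈? T)) (ℤP.*-zeroʳ (ω i T))) (unless-0 (i ∈? T)))
    zeroˡ : ∀ i j → i ∈ T → F i j ≡ 0ℤ
    zeroˡ i j i∈T = unless-yes (i ∈? T) i∈T
    zeroʳ : ∀ i j → i ∈ T → F j i ≡ 0ℤ
    zeroʳ i j i∈T = inner-zero (x∈p⇒x∈p∪⁅y⁆ j i∈T)
    diagonal : ∀ i → F i i ≡ 0ℤ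
    diagonal i = inner-zero (x∈p∪⁅x⁆ i)
    U : Fin k → Fin k → Subset k
    U i j = (T ∪ ⁅ i ⁆) ∪ ⁅ j ⁆
    Φ : Fin k → Fin k → ℤ
    Φ i j = (c (U i j) y - c (U i j) (ℓ[ j ]* y)) - (c (U i j) (ℓ[ i ]* y) - c (U i j) (ℓ[ j ]* ℓ[ i ]* y))
    Φ-sym : ∀ i j → Φ i j ≡ Φ j i
    Φ-sym i j = trans (solve 4 (λ a b c d → (a :- b) :- (c :- d) := (a :- c) :- (b :- d)) refl
        (c (U i j) y) (c (U i j) (ℓ[ j ]* y)) (c (U i j) (ℓ[ i ]* y)) (c (U i j) (ℓ[ j ]* ℓ[ i ]* y)))
      (cong₂ (λ V z → (c V y - c V (ℓ[ i ]* y)) - (c V (ℓ[ j ]* y) - c V z))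
             (p∪⁅x⁆∪q≡p∪q∪⁅x⁆ T ⁅ j ⁆ i) (ℓ[]*-comm j i y))
    F-generic : ∀ {i j} → i ∉ T → j ∉ T → ¬ i ≡ j → F i j ≡ ω i T * (ω j (T ∪ ⁅ i ⁆) * Φ i j)
    F-generic {i} {j} i∉T j∉T i≢j = trans (unless-no (i ∈? T) i∉T) (cong (ω i T *_) (trans
      (cong₂ _-_ (unless-no (j ∈? _) j∉) (unless-no (j ∈? _) j∉))
      (sym (*-distribˡ-- (ω j (T ∪ ⁅ i ⁆)) (c (U i j) y - c (U i j) (ℓ[ j ]* y))
                                            (c (U i j) (ℓ[ i ]* y) - c (U i j) (ℓ[ j ]* ℓ[ i ]* y))))))
      where j∉ = x∉p⇒x∉p∪⁅y⁆ j∉T (i≢j ∘ sym)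
    generic : ∀ i j → i ∉ T → j ∉ T → ¬ i ≡ j → F i j ≡ - F j i
    generic i j i∉T j∉T i≢j = begin
      F i j                                  ≡⟨ F-generic i∉T j∉T i≢j ⟩
      ω i T * (ω j (T ∪ ⁅ i ⁆) * Φ i j)      ≡⟨ koszul-sign i∉T j∉T i≢j (Φ i j) ⟩
      - (ω j T * (ω i (T ∪ ⁅ j ⁆) * Φ i j))  ≡⟨ cong (λ z → - (ω j T * (ω i (T ∪ ⁅ j ⁆) * z))) (Φ-sym i j) ⟩
      - (ω j T * (ω i (T ∪ ⁅ j ⁆) * Φ j i))  ≡⟨ cong -_ (F-generic j∉T i∉T (i≢j ∘ sym)) ⟨
      - F j i                                ∎
      where open ≡-Reasoning

  -- The type-preserving part of the differential

  δ-term : Chain → Subset k → Num → Fin k → ℤ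
  δ-term c T y i = unless (i ∈? T) (unless (ℓ[ i ]∣? y) (- (ω i T * c (T ∪ ⁅ i ⁆) (ℓ[ i ]* y))))

  δ : Chain → Chain
  δ c T y = sumFin k (δ-term c T y)

  δ-term-excluded : ∀ c V z j → j ∈ V ⊎ ℓ[ j ]∣ z → δ-term c V z j ≡ 0ℤ
  δ-term-excluded c V z j (inj₁ j∈V)  = unless-yes (j ∈? V) j∈V
  δ-term-excluded c V z j (inj₂ ℓj∣z) = trans (cong (unless (j ∈? V)) (unless-yes (ℓ[ j ]∣? z) ℓj∣z)) (unless-0 (j ∈? V))

  δ-term-vanishes : ∀ c V z j → c (V ∪ ⁅ j ⁆) (ℓ[ j ]* z) ≡ 0ℤ → δ-term c V z j ≡ 0ℤ
  δ-term-vanishes c V z j = unless-unless-vanishes (j ∈? V) (ℓ[ j ]∣? z) (ω j V)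

  δ-⊕ : ∀ a b → δ (a ⊕ b) ≈C (δ a ⊕ δ b)
  δ-⊕ a b T y = trans (sumFin-cong k term) (sumFin-+ k _ _)
    where
    term : ∀ i → δ-term (a ⊕ b) T y i ≡ δ-term a T y i + δ-term b T y i
    term i with i ∈? T | ℓ[ i ]∣? y
    ... | yes _ | _     = refl
    ... | no _  | yes _ = refl
    ... | no _  | no _  = solve 3 (λ w p q → :- (w :* (p :+ q)) := :- (w :* p) :+ :- (w :* q)) refl
      (ω i T) (a (T ∪ ⁅ i ⁆) (ℓ[ i ]* y)) (b (T ∪ ⁅ i ⁆) (ℓ[ i ]* y))

  δ-⊖ : ∀ a b → δ (a ⊖ b) ≈C (δ a ⊖ δ b)
  δ-⊖ a b T y = trans (sumFin-cong k term) (sumFin-- k _ _)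
    where
    term : ∀ i → δ-term (a ⊖ b) T y i ≡ δ-term a T y i - δ-term b T y i
    term i with i ∈? T | ℓ[ i ]∣? y
    ... | yes _ | _     = refl
    ... | no _  | yes _ = refl
    ... | no _  | no _  = solve 3 (λ w p q → :- (w :* (p :- q)) := :- (w :* p) :- :- (w :* q)) refl
      (ω i T) (a (T ∪ ⁅ i ⁆) (ℓ[ i ]* y)) (b (T ∪ ⁅ i ⁆) (ℓ[ i ]* y))

  δ-0 : ∀ T y → δ zeroC T y ≡ 0ℤ
  δ-0 T y = sumFin-0 k λ i → δ-term-vanishes zeroC T y i refl

  δ-≢0 : ∀ c T y → ¬ δ c T y ≡ 0ℤ → ∃ λ i → i ∉ T × ¬ ℓ[ i ]∣ y × ¬ c (T ∪ ⁅ i ⁆) (ℓ[ i ]* y) ≡ 0ℤ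
  δ-≢0 c T y δ≢0 with sumFin-≢0 k (δ-term c T y) δ≢0
  ... | i , term≢0 with unless-≢0 (i ∈? T) term≢0
  ...   | i∉T , ≢0 with unless-≢0 (ℓ[ i ]∣? y) ≢0
  ...     | ℓi∤y , -ωc≢0 = i , i∉T , ℓi∤y , ≢0-*ʳ (ω i T) _ (≢0-neg _ -ωc≢0)

  δ-Homog : ∀ {n c} → Homog (suc n) c → Homog n (δ c)
  δ-Homog {n} {c} hom = supported⇒Homog λ T y δ≢0 → ℕP.suc-injective (lemma T y (δ-≢0 c T y δ≢0))
    where
    lemma : ∀ T y → ∃ (λ i → i ∉ T × ¬ ℓ[ i ]∣ y × ¬ c (T ∪ ⁅ i ⁆) (ℓ[ i ]* y) ≡ 0ℤ) → suc ∣ T ∣ ≡ suc n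
    lemma T y (i , i∉T , _ , c≢0) =
      trans (sym (x∉p⇒∣p∪⁅x⁆∣≡1+∣p∣ i∉T)) (Homog⇒supported hom (T ∪ ⁅ i ⁆) (ℓ[ i ]* y) c≢0)

  δδ≡0 : ∀ c T y → δ (δ c) T y ≡ 0ℤ
  δδ≡0 c T y = trans (sumFin-cong k expand) (sumFin-antisym k G (antisym-by-cases excluded? G zeroˡ zeroʳ diagonal generic))
    where
    Excluded : Fin k → Set
    Excluded i = i ∈ T ⊎ ℓ[ i ]∣ y
    excluded? : ∀ i → Dec (Excluded i)
    excluded? i = (i ∈? T) ⊎-dec (ℓ[ i ]∣? y)
    G : Fin k → Fin k → ℤ
    G i j = unless (i ∈? T) (unless (ℓ[ i ]∣? y) (- (ω i T * δ-term c (T ∪ ⁅ i ⁆) (ℓ[ i ]* y) j)))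
    expand : ∀ i → δ-term (δ c) T y i ≡ sumFin k (G i)
    expand i = begin
      unless (i ∈? T) (unless (ℓ[ i ]∣? y) (- (ω i T * sumFin k (δ-term c (T ∪ ⁅ i ⁆) (ℓ[ i ]* y)))))
        ≡⟨ cong (λ z → unless (i ∈? T) (unless (ℓ[ i ]∣? y) (- z))) (sumFin-*ˡ k (ω i T) _) ⟨
      unless (i ∈? T) (unless (ℓ[ i ]∣? y) (- sumFin k (λ j → ω i T * δ-term c (T ∪ ⁅ i ⁆) (ℓ[ i ]* y) j)))
        ≡⟨ cong (λ z → unless (i ∈? T) (unless (ℓ[ i ]∣? y) z)) (sumFin-neg k _) ⟨
      unless (i ∈? T) (unless (ℓ[ i ]∣? y) (sumFin k (λ j → - (ω i T * δ-term c (T ∪ ⁅ i ⁆) (ℓ[ i ]* y) j))))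
        ≡⟨ cong (unless (i ∈? T)) (unless-sumFin (ℓ[ i ]∣? y) k _) ⟩
      unless (i ∈? T) (sumFin k (λ j → unless (ℓ[ i ]∣? y) (- (ω i T * δ-term c (T ∪ ⁅ i ⁆) (ℓ[ i ]* y) j))))
        ≡⟨ unless-sumFin (i ∈? T) k _ ⟩
      sumFin k (G i) ∎
      where open ≡-Reasoning
    inner-zero : ∀ i j → j ∈ T ∪ ⁅ i ⁆ ⊎ ℓ[ j ]∣ ℓ[ i ]* y → G i j ≡ 0ℤ
    inner-zero i j excl = unless-unless-vanishes (i ∈? T) (ℓ[ i ]∣? y) (ω i T) (δ-term-excluded c (T ∪ ⁅ i ⁆) (ℓ[ i ]* y) j excl)
    zeroˡ : ∀ i j → Excluded i → G i j ≡ 0ℤ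
    zeroˡ i j (inj₁ i∈T)  = unless-yes (i ∈? T) i∈T
    zeroˡ i j (inj₂ ℓi∣y) = trans (cong (unless (i ∈? T)) (unless-yes (ℓ[ i ]∣? y) ℓi∣y)) (unless-0 (i ∈? T))
    zeroʳ : ∀ i j → Excluded i → G j i ≡ 0ℤ
    zeroʳ i j (inj₁ i∈T)  = inner-zero j i (inj₁ (x∈p⇒x∈p∪⁅y⁆ j i∈T))
    zeroʳ i j (inj₂ ℓi∣y) = inner-zero j i (inj₂ (∣-ℓ[]*⁺ j ℓi∣y))
    diagonal : ∀ i → G i i ≡ 0ℤ
    diagonal i = inner-zero i i (inj₁ (x∈p∪⁅x⁆ i))
    X : Fin k → Fin k → ℤ
    X i j = c ((T ∪ ⁅ i ⁆) ∪ ⁅ j ⁆) (ℓ[ j ]* ℓ[ i ]* y)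
    G-generic : ∀ i j → ¬ Excluded i → ¬ Excluded j → ¬ i ≡ j → G i j ≡ ω i T * (ω j (T ∪ ⁅ i ⁆) * X i j)
    G-generic i j ¬Ei ¬Ej i≢j = begin
      G i j
        ≡⟨ trans (unless-no (i ∈? T) (¬Ei ∘ inj₁)) (unless-no (ℓ[ i ]∣? y) (¬Ei ∘ inj₂)) ⟩
      - (ω i T * δ-term c (T ∪ ⁅ i ⁆) (ℓ[ i ]* y) j)
        ≡⟨ cong (λ z → - (ω i T * z)) (trans (unless-no (j ∈? _) (x∉p⇒x∉p∪⁅y⁆ (¬Ej ∘ inj₁) (i≢j ∘ sym)))
                                             (unless-no (ℓ[ j ]∣? _) (¬Ej ∘ inj₂ ∘ ∣-ℓ[]*⁻ i≢j))) ⟩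
      - (ω i T * - (ω j (T ∪ ⁅ i ⁆) * X i j))
        ≡⟨ solve 3 (λ a b x → :- (a :* (:- (b :* x))) := a :* (b :* x)) refl (ω i T) (ω j (T ∪ ⁅ i ⁆)) (X i j) ⟩
      ω i T * (ω j (T ∪ ⁅ i ⁆) * X i j) ∎
      where open ≡-Reasoning
    generic : ∀ i j → ¬ Excluded i → ¬ Excluded j → ¬ i ≡ j → G i j ≡ - G j i
    generic i j ¬Ei ¬Ej i≢j = begin
      G i j                                  ≡⟨ G-generic i j ¬Ei ¬Ej i≢j ⟩
      ω i T * (ω j (T ∪ ⁅ i ⁆) * X i j)      ≡⟨ koszul-sign (¬Ei ∘ inj₁) (¬Ej ∘ inj₁) i≢j (X i j) ⟩
      - (ω j T * (ω i (T ∪ ⁅ j ⁆) * X i j))  ≡⟨ cong (λ z → - (ω j T * (ω i (T ∪ ⁅ j ⁆) * z)))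
                                                  (cong₂ c (p∪⁅x⁆∪q≡p∪q∪⁅x⁆ T ⁅ j ⁆ i) (ℓ[]*-comm j i y)) ⟩
      - (ω j T * (ω i (T ∪ ⁅ j ⁆) * X j i))  ≡⟨ cong -_ (G-generic j i ¬Ej ¬Ei (i≢j ∘ sym)) ⟨
      - G j i                                ∎
      where open ≡-Reasoning

  Generator : Subset k → Num → Set
  Generator T y = ∀ {j} → j ∈ T → ℓ[ j ]∣ y

  -- The cells of type τ are those InPiece τ (DivisibleOff τ); the extra condition O is what changes
  -- when the induction below removes one prime from τ.
  record InPiece (τ : Subset k) (O : Subset k → Num → Set) (T : Subset k) (y : Num) : Set where
    field
      generator  : Generator T y
      within     : T ⊆ τ
      coprime    : ∀ {j} → j ∈ τ → j ∉ T → ¬ ℓ[ j ]∣ y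
      satisfies  : O T y
  open InPiece

  δ-Closed : Subset k → (Subset k → Num → Set) → Set
  δ-Closed τ O = ∀ {i T y} → i ∈ τ → i ∉ T → O (T ∪ ⁅ i ⁆) (ℓ[ i ]* y) → O T y

  h-Closed : Subset k → (Subset k → Num → Set) → Set
  h-Closed τ O = ∀ {m T y} → m ∈ τ → m ∉ T → O T y → O (T ∪ ⁅ m ⁆) (ℓ[ m ]* y)

  δ-supported : ∀ {τ O} → δ-Closed τ O → ∀ {c} → SupportedOn (InPiece τ O) c → SupportedOn (InPiece τ O) (δ c)
  δ-supported {τ} {O} O-δ {c} supp T y δ≢0 with δ-≢0 c T y δ≢0
  ... | i , i∉T , ℓi∤y , c≢0 = record
    { generator = λ j∈T → ∣-ℓ[]*⁻ (i≢ j∈T) (generator g (x∈p⇒x∈p∪⁅y⁆ i j∈T))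
    ; within    = within g ∘ x∈p⇒x∈p∪⁅y⁆ i
    ; coprime   = coprime′
    ; satisfies = O-δ (within g (x∈p∪⁅x⁆ i)) i∉T (satisfies g)
    }
    where
    g : InPiece τ O (T ∪ ⁅ i ⁆) (ℓ[ i ]* y)
    g = supp _ _ c≢0
    i≢ : ∀ {j} → j ∈ T → ¬ i ≡ j
    i≢ j∈T refl = i∉T j∈T
    coprime′ : ∀ {j} → j ∈ τ → j ∉ T → ¬ ℓ[ j ]∣ y
    coprime′ {j} j∈τ j∉T with j FinP.≟ i
    ... | yes refl = ℓi∤y
    ... | no j≢i   = coprime g j∈τ (x∉p⇒x∉p∪⁅y⁆ j∉T j≢i) ∘ ∣-ℓ[]*⁺ i

  -- Normalising the root by r_T keeps the pairing of (T, y) with (T ∪ {m}, ℓ_m y) compatible with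
  -- multiplication by the other ℓ_i (Normal-∪⁅⁆); the unpaired cells form the piece of τ ∖ m cut out
  -- by Remaining.
  module Homotopy {τ : Subset k} {O : Subset k → Num → Set} (O-δ : δ-Closed τ O) (O-h : h-Closed τ O)
                  {m : Fin k} (m∈τ : m ∈ τ) where

    Normal : Subset k → Num → Set
    Normal T y = ⟪ y ⟫ ≡ + rT T mod ℓ m

    Normal⇒∤ : ∀ {T y} → m ∉ T → Normal T y → ¬ ℓ[ m ]∣ y
    Normal⇒∤ m∉T normal ℓm∣y =
      prodSub-∉⇒∤ ℓ-prime ℓ-injective m∉T (ℤD.∣⇒∣ᵤ (≡-mod-∣ normal (ℤD.∣ᵤ⇒∣ ℓm∣y)))

    Normal-∪⁅⁆ : ∀ {i T y} → i ∉ T → Normal T y → Normal (T ∪ ⁅ i ⁆) (ℓ[ i ]* y)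
    Normal-∪⁅⁆ {i} {T} {y} i∉T normal = begin
      ⟪ ℓ[ i ]* y ⟫        ≈⟨ ℓ[]*-≡[ℓ] i m y ⟩
      + ℓ i * ⟪ y ⟫        ≈⟨ ≡-mod-*ˡ (+ ℓ i) normal ⟩
      + ℓ i * + rT T       ≡⟨ trans (sym (ℤP.pos-* (ℓ i) (rT T))) (cong +_ (sym (prodSub-∪⁅⁆ ℓ i∉T))) ⟩
      + rT (T ∪ ⁅ i ⁆)     ∎
      where open ≡-mod-Reasoning (ℓ m)

    Normal-∪⁅⁆⁻ : ∀ {i T y} → ¬ i ≡ m → i ∉ T → Normal (T ∪ ⁅ i ⁆) (ℓ[ i ]* y) → Normal T y
    Normal-∪⁅⁆⁻ {i} {T} {y} i≢m i∉T normal = ≡-mod-cancel-prime (ℓ-prime m) (ℓ∤ℓ i≢m) (begin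
      + ℓ i * ⟪ y ⟫        ≈⟨ ℓ[]*-≡[ℓ] i m y ⟨
      ⟪ ℓ[ i ]* y ⟫        ≈⟨ normal ⟩
      + rT (T ∪ ⁅ i ⁆)     ≡⟨ trans (cong +_ (prodSub-∪⁅⁆ ℓ i∉T)) (ℤP.pos-* (ℓ i) (rT T)) ⟩
      + ℓ i * + rT T       ∎)
      where open ≡-mod-Reasoning (ℓ m)

    lift : Subset k → Num → Num
    lift T w with ℓ[ m ]∣? w
    ... | yes ℓm∣w = proj₁ (root m (+ rT T) ℓm∣w)
    ... | no _     = w   -- arbitrary: h only lifts multiples of ℓ_m

    lift-spec : ∀ T {w} → ℓ[ m ]∣ w → (ℓ[ m ]* lift T w ≡ w) × Normal T (lift T w)
    lift-spec T {w} ℓm∣w with ℓ[ m ]∣? w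
    ... | yes ℓm∣w′ = proj₂ (root m (+ rT T) ℓm∣w′)
    ... | no ℓm∤w   = contradiction ℓm∣w ℓm∤w

    lift-unique : ∀ {T y} → Normal T y → lift T (ℓ[ m ]* y) ≡ y
    lift-unique {T} {y} normal = root-unique m (proj₁ spec) (≡-mod-trans (proj₂ spec) (≡-mod-sym normal))
      where
      spec : (ℓ[ m ]* lift T (ℓ[ m ]* y) ≡ ℓ[ m ]* y) × Normal T (lift T (ℓ[ m ]* y))
      spec = lift-spec T (∣-ℓ[]*-self m y)

    h : Chain → Chain
    h z T w = when (m ∈? T) (when (ℓ[ m ]∣? w) (- (ω m T * z (T ∖ m) (lift (T ∖ m) w))))

    h-≢0 : ∀ z T w → ¬ h z T w ≡ 0ℤ → m ∈ T × ℓ[ m ]∣ w × ¬ z (T ∖ m) (lift (T ∖ m) w) ≡ 0ℤ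
    h-≢0 z T w h≢0 with when-≢0 (m ∈? T) h≢0
    ... | m∈T , ≢0 with when-≢0 (ℓ[ m ]∣? w) ≢0
    ...   | ℓm∣w , -ωz≢0 = m∈T , ℓm∣w , ≢0-*ʳ (ω m T) _ (≢0-neg _ -ωz≢0)

    h-vanishes : ∀ z {T} w → m ∉ T → h z T w ≡ 0ℤ
    h-vanishes z {T} w m∉T = when-no (m ∈? T) m∉T

    h-supported : ∀ {z} → SupportedOn (InPiece τ O) z → SupportedOn (InPiece τ O) (h z)
    h-supported {z} supp T w h≢0 with h-≢0 z T w h≢0
    ... | m∈T , ℓm∣w , z≢0 = record
      { generator = generator′
      ; within    = within′
      ; coprime   = coprime′
      ; satisfies = subst₂ O (x∈p⇒p∖x∪⁅x⁆≡p m∈T) ℓms≡w (O-h m∈τ (x∉p∖x T m) (satisfies g))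
      }
      where
      s : Num
      s = lift (T ∖ m) w
      ℓms≡w : ℓ[ m ]* s ≡ w
      ℓms≡w = proj₁ (lift-spec (T ∖ m) ℓm∣w)
      g : InPiece τ O (T ∖ m) s
      g = supp _ _ z≢0
      generator′ : Generator T w
      generator′ {j} j∈T with j FinP.≟ m
      ... | yes refl = ℓm∣w
      ... | no j≢m   = subst (ℓ[ j ]∣_) ℓms≡w (∣-ℓ[]*⁺ m (generator g (SubP.x∈p∧x≢y⇒x∈p-y j∈T j≢m)))
      within′ : T ⊆ τ
      within′ {j} j∈T with j FinP.≟ m
      ... | yes refl = m∈τ
      ... | no j≢m   = within g (SubP.x∈p∧x≢y⇒x∈p-y j∈T j≢m)
      coprime′ : ∀ {j} → j ∈ τ → j ∉ T → ¬ ℓ[ j ]∣ w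
      coprime′ j∈τ j∉T ℓj∣w = coprime g j∈τ (j∉T ∘ proj₁ ∘ x∈p∖y⁻)
        (∣-ℓ[]*⁻ (λ { refl → j∉T m∈T }) (subst (ℓ[ _ ]∣_) (sym ℓms≡w) ℓj∣w))

    h-Homog : ∀ {n z} → Homog (suc n) z → Homog (suc (suc n)) (h z)
    h-Homog {n} {z} hom = supported⇒Homog λ T w h≢0 → lemma T w (h-≢0 z T w h≢0)
      where
      lemma : ∀ T w → m ∈ T × ℓ[ m ]∣ w × ¬ z (T ∖ m) (lift (T ∖ m) w) ≡ 0ℤ → ∣ T ∣ ≡ suc (suc n)
      lemma T w (m∈T , _ , z≢0) = trans (x∈p⇒∣p∣≡1+∣p∖x∣ m∈T) (cong suc (Homog⇒supported hom _ _ z≢0))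

    δh-normal : ∀ z {T y} → m ∉ T → Normal T y → δ (h z) T y ≡ z T y
    δh-normal z {T} {y} m∉T normal = trans (sumFin-single k m others) at-m
      where
      others : ∀ i → ¬ i ≡ m → δ-term (h z) T y i ≡ 0ℤ
      others i i≢m = δ-term-vanishes (h z) T y i (h-vanishes z _ (x∉p⇒x∉p∪⁅y⁆ m∉T (i≢m ∘ sym)))
      at-m : δ-term (h z) T y m ≡ z T y
      at-m = begin
        δ-term (h z) T y m
          ≡⟨ trans (unless-no (m ∈? T) m∉T) (unless-no (ℓ[ m ]∣? y) (Normal⇒∤ m∉T normal)) ⟩
        - (ω m T * h z (T ∪ ⁅ m ⁆) (ℓ[ m ]* y))
          ≡⟨ cong (λ v → - (ω m T * v))
                  (trans (when-yes (m ∈? _) (x∈p∪⁅x⁆ m)) (when-yes (ℓ[ m ]∣? _) (∣-ℓ[]*-self m y))) ⟩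
        - (ω m T * - (ω m (T ∪ ⁅ m ⁆) * z ((T ∪ ⁅ m ⁆) ∖ m) (lift ((T ∪ ⁅ m ⁆) ∖ m) (ℓ[ m ]* y))))
          ≡⟨ cong₂ (λ w V → - (ω m T * - (w * z V (lift V (ℓ[ m ]* y))))) (ω-∪⁅self⁆ m T) (x∉p⇒p∪⁅x⁆∖x≡p m∉T) ⟩
        - (ω m T * - (ω m T * z T (lift T (ℓ[ m ]* y))))
          ≡⟨ cong (λ v → - (ω m T * - (ω m T * z T v))) (lift-unique normal) ⟩
        - (ω m T * - (ω m T * z T y))
          ≡⟨ solve 2 (λ w t → :- (w :* (:- (w :* t))) := (w :* w) :* t) refl (ω m T) (z T y) ⟩
        ω m T * ω m T * z T y
          ≡⟨ trans (cong (_* z T y) (ω*ω≡1 m T)) (ℤP.*-identityˡ _) ⟩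
        z T y ∎
        where open ≡-Reasoning

    module _ (z : Chain) (cycle : ∀ T y → δ z T y ≡ 0ℤ) {T x} (m∈T : m ∈ T) (ℓm∣x : ℓ[ m ]∣ x) where

      private
        U : Subset k
        U = T ∖ m
        s : Num
        s = lift U x
        ℓms≡x : ℓ[ m ]* s ≡ x
        ℓms≡x = proj₁ (lift-spec U ℓm∣x)
        m∉U : m ∉ U
        m∉U = x∉p∖x T m
        U∪m≡T : U ∪ ⁅ m ⁆ ≡ T
        U∪m≡T = x∈p⇒p∖x∪⁅x⁆≡p m∈T

      lifted-term-m : δ-term z U s m ≡ - (ω m U * z T x)
      lifted-term-m = trans (unless-no (m ∈? U) m∉U)
        (trans (unless-no (ℓ[ m ]∣? s) (Normal⇒∤ m∉U (proj₂ (lift-spec U ℓm∣x))))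
               (cong₂ (λ V v → - (ω m U * z V v)) U∪m≡T ℓms≡x))

      lifted-term-generic : ∀ i → ¬ i ≡ m → i ∉ T → ¬ ℓ[ i ]∣ x → δ-term (h z) T x i ≡ ω m U * δ-term z U s i
      lifted-term-generic i i≢m i∉T ℓi∤x = begin
        δ-term (h z) T x i
          ≡⟨ trans (unless-no (i ∈? T) i∉T) (unless-no (ℓ[ i ]∣? x) ℓi∤x) ⟩
        - (ω i T * h z (T ∪ ⁅ i ⁆) (ℓ[ i ]* x))
          ≡⟨ cong (λ v → - (ω i T * v))
                  (trans (when-yes (m ∈? _) (x∈p⇒x∈p∪⁅y⁆ i m∈T)) (when-yes (ℓ[ m ]∣? _) (∣-ℓ[]*⁺ i ℓm∣x))) ⟩
        - (ω i T * - (ω m (T ∪ ⁅ i ⁆) * z ((T ∪ ⁅ i ⁆) ∖ m) (lift ((T ∪ ⁅ i ⁆) ∖ m) (ℓ[ i ]* x))))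
          ≡⟨ cong (λ V → - (ω i T * - (ω m (T ∪ ⁅ i ⁆) * z V (lift V (ℓ[ i ]* x)))))
                  (x≢y⇒p∪⁅x⁆∖y≡p∖y∪⁅x⁆ i≢m) ⟩
        - (ω i T * - (ω m (T ∪ ⁅ i ⁆) * z (U ∪ ⁅ i ⁆) (lift (U ∪ ⁅ i ⁆) (ℓ[ i ]* x))))
          ≡⟨ cong (λ v → - (ω i T * - (ω m (T ∪ ⁅ i ⁆) * z (U ∪ ⁅ i ⁆) v))) lift-ℓix ⟩
        - (ω i T * - (ω m (T ∪ ⁅ i ⁆) * Z))
          ≡⟨ cong₂ (λ a b → - (a * - (b * Z))) ωiT ωmTi ⟩
        - (ε m i * ω i U * - (- ε m i * ω m U * Z))
          ≡⟨ solve 4 (λ e a b Z → :- (e :* a :* (:- ((:- e) :* b :* Z))) := (e :* e) :* (b :* (:- (a :* Z))))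
                     refl (ε m i) (ω i U) (ω m U) Z ⟩
        ε m i * ε m i * (ω m U * - (ω i U * Z))
          ≡⟨ trans (cong (_* (ω m U * - (ω i U * Z))) (ε*ε≡1 m i)) (ℤP.*-identityˡ _) ⟩
        ω m U * - (ω i U * Z)
          ≡⟨ cong (ω m U *_) (trans (unless-no (i ∈? U) i∉U) (unless-no (ℓ[ i ]∣? s) ℓi∤s)) ⟨
        ω m U * δ-term z U s i ∎
        where
        open ≡-Reasoning
        Z : ℤ
        Z = z (U ∪ ⁅ i ⁆) (ℓ[ i ]* s)
        i∉U : i ∉ U
        i∉U = i∉T ∘ proj₁ ∘ x∈p∖y⁻
        ℓi∤s : ¬ ℓ[ i ]∣ s
        ℓi∤s ℓi∣s = ℓi∤x (subst (ℓ[ i ]∣_) ℓms≡x (∣-ℓ[]*⁺ m ℓi∣s))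
        lift-ℓix : lift (U ∪ ⁅ i ⁆) (ℓ[ i ]* x) ≡ ℓ[ i ]* s
        lift-ℓix = trans (cong (lift (U ∪ ⁅ i ⁆)) (trans (cong ℓ[ i ]*_ (sym ℓms≡x)) (ℓ[]*-comm i m s)))
                         (lift-unique (Normal-∪⁅⁆ i∉U (proj₂ (lift-spec U ℓm∣x))))
        ωiT : ω i T ≡ ε m i * ω i U
        ωiT = trans (cong (ω i) (sym U∪m≡T)) (ω-∪⁅⁆ m∉U)
        ωmTi : ω m (T ∪ ⁅ i ⁆) ≡ - ε m i * ω m U
        ωmTi = begin
          ω m (T ∪ ⁅ i ⁆)            ≡⟨ cong (λ V → ω m (V ∪ ⁅ i ⁆)) (sym U∪m≡T) ⟩
          ω m ((U ∪ ⁅ m ⁆) ∪ ⁅ i ⁆)  ≡⟨ cong (ω m) (p∪⁅x⁆∪q≡p∪q∪⁅x⁆ U ⁅ i ⁆ m) ⟩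
          ω m ((U ∪ ⁅ i ⁆) ∪ ⁅ m ⁆)  ≡⟨ ω-∪⁅self⁆ m (U ∪ ⁅ i ⁆) ⟩
          ω m (U ∪ ⁅ i ⁆)            ≡⟨ ω-∪⁅⁆ i∉U ⟩
          ε i m * ω m U              ≡⟨ cong (_* ω m U) (ε-anti i≢m) ⟩
          - ε m i * ω m U            ∎

      lifted-term : ∀ i → ¬ i ≡ m → δ-term (h z) T x i ≡ ω m U * δ-term z U s i
      lifted-term i i≢m = cases (i ∈? T) (ℓ[ i ]∣? x)
        where
        cases : Dec (i ∈ T) → Dec (ℓ[ i ]∣ x) → δ-term (h z) T x i ≡ ω m U * δ-term z U s i
        cases (yes i∈T) _ = trans (unless-yes (i ∈? T) i∈T)
          (sym (trans (cong (ω m U *_) (unless-yes (i ∈? U) (SubP.x∈p∧x≢y⇒x∈p-y i∈T i≢m))) (ℤP.*-zeroʳ (ω m U))))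
        cases (no i∉T) (yes ℓi∣x) = trans (trans (unless-no (i ∈? T) i∉T) (unless-yes (ℓ[ i ]∣? x) ℓi∣x))
          (sym (trans (cong (ω m U *_) (δ-term-excluded z U s i (inj₂ ℓi∣s))) (ℤP.*-zeroʳ (ω m U))))
          where
          ℓi∣s : ℓ[ i ]∣ s
          ℓi∣s = ∣-ℓ[]*⁻ (i≢m ∘ sym) (subst (ℓ[ i ]∣_) (sym ℓms≡x) ℓi∣x)
        cases (no i∉T) (no ℓi∤x) = lifted-term-generic i i≢m i∉T ℓi∤x

      δh-lifted : δ (h z) T x ≡ z T x
      δh-lifted = begin
        δ (h z) T x
          ≡⟨ solve 2 (λ b a → b := (b :- a) :+ a) refl (δ (h z) T x) (sumFin k (λ i → ω m U * δ-term z U s i)) ⟩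
        (δ (h z) T x - sumFin k (λ i → ω m U * δ-term z U s i)) + sumFin k (λ i → ω m U * δ-term z U s i)
          ≡⟨ cong₂ _+_ (sumFin-agree-off k m lifted-term) (sumFin-*ˡ k (ω m U) _) ⟩
        (δ-term (h z) T x m - ω m U * δ-term z U s m) + ω m U * δ z U s
          ≡⟨ cong₂ (λ a b → (a - ω m U * b) + ω m U * δ z U s) (unless-yes (m ∈? T) m∈T) lifted-term-m ⟩
        (0ℤ - ω m U * - (ω m U * z T x)) + ω m U * δ z U s
          ≡⟨ cong (λ v → (0ℤ - ω m U * - (ω m U * z T x)) + ω m U * v) (cycle U s) ⟩
        (0ℤ - ω m U * - (ω m U * z T x)) + ω m U * 0ℤ
          ≡⟨ solve 2 (λ w t → (con 0ℤ :- w :* (:- (w :* t))) :+ w :* con 0ℤ := (w :* w) :* t) refl (ω m U) (z T x) ⟩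
        ω m U * ω m U * z T x
          ≡⟨ trans (cong (_* z T x) (ω*ω≡1 m U)) (ℤP.*-identityˡ _) ⟩
        z T x ∎
        where open ≡-Reasoning

    Remaining : Subset k → Num → Set
    Remaining T y = O T y × ¬ ℓ[ m ]∣ y × ¬ Normal T y

    Remaining-δ : δ-Closed (τ ∖ m) Remaining
    Remaining-δ {i} {T} {y} i∈τ∖m i∉T (o , ℓm∤ , ¬normal) =
      O-δ (proj₁ (x∈p∖y⁻ i∈τ∖m)) i∉T o , ℓm∤ ∘ ∣-ℓ[]*⁺ i {y = y} , ¬normal ∘ Normal-∪⁅⁆ {y = y} i∉T

    Remaining-h : h-Closed (τ ∖ m) Remaining
    Remaining-h {m′} {T} {y} m′∈τ∖m m′∉T (o , ℓm∤ , ¬normal) =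
      O-h m′∈τ m′∉T o , ℓm∤ ∘ ∣-ℓ[]*⁻ {y = y} m′≢m , ¬normal ∘ Normal-∪⁅⁆⁻ {y = y} m′≢m m′∉T
      where
      m′∈τ : m′ ∈ τ
      m′∈τ = proj₁ (x∈p∖y⁻ m′∈τ∖m)
      m′≢m : ¬ m′ ≡ m
      m′≢m = proj₂ (x∈p∖y⁻ m′∈τ∖m)

    forget : ∀ {T y} → InPiece (τ ∖ m) Remaining T y → InPiece τ O T y
    forget {T} {y} g = record
      { generator = generator g
      ; within    = proj₁ ∘ x∈p∖y⁻ ∘ within g
      ; coprime   = coprime′
      ; satisfies = proj₁ (satisfies g)
      }
      where
      coprime′ : ∀ {j} → j ∈ τ → j ∉ T → ¬ ℓ[ j ]∣ y
      coprime′ {j} j∈τ j∉T with j FinP.≟ m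
      ... | yes refl = proj₁ (proj₂ (satisfies g))
      ... | no j≢m   = coprime g (SubP.x∈p∧x≢y⇒x∈p-y j∈τ j≢m) j∉T

    remainder-supported : ∀ {z} → SupportedOn (InPiece τ O) z → (∀ T y → δ z T y ≡ 0ℤ) →
      SupportedOn (InPiece (τ ∖ m) Remaining) (z ⊖ δ (h z))
    remainder-supported {z} supp cycle T y ≢0 = cases (m ∈? T) (≡-mod-dec ⟪ y ⟫ (+ rT T))
      where
      g : InPiece τ O T y
      g = supported-⊖ supp (δ-supported O-δ (h-supported supp)) T y ≢0
      ¬cancels : ¬ δ (h z) T y ≡ z T y
      ¬cancels δhz≡z = ≢0 (trans (cong (_-_ (z T y)) δhz≡z) (ℤP.+-inverseʳ (z T y)))
      cases : Dec (m ∈ T) → Dec (Normal T y) → InPiece (τ ∖ m) Remaining T y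
      cases (yes m∈T) _            = contradiction (δh-lifted z cycle m∈T (generator g m∈T)) ¬cancels
      cases (no m∉T)  (yes normal) = contradiction (δh-normal z m∉T normal) ¬cancels
      cases (no m∉T)  (no ¬normal) = record
        { generator = generator g
        ; within    = λ j∈T → SubP.x∈p∧x≢y⇒x∈p-y (within g j∈T) λ { refl → m∉T j∈T }
        ; coprime   = coprime g ∘ proj₁ ∘ x∈p∖y⁻
        ; satisfies = satisfies g , coprime g m∈τ m∉T , ¬normal
        }

  δ-acyclic : ∀ N {τ} → ∣ τ ∣ ≡ N → ∀ {O} → δ-Closed τ O → h-Closed τ O →
    ∀ {n z} → SupportedOn (InPiece τ O) z → Homog (suc n) z → (∀ T y → δ z T y ≡ 0ℤ) →
    Σ Chain λ b → SupportedOn (InPiece τ O) b × Homog (suc (suc n)) b × δ b ≈C z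
  δ-acyclic zero ∣τ∣≡0 _ _ {n} {z} supp hom _ =
    zeroC , supported-0 , (λ _ _ _ → refl) , λ T y → trans (δ-0 T y) (sym (z≡0 T y))
    where
    z≡0 : ∀ T y → z T y ≡ 0ℤ
    z≡0 T y = ≡0-stable (z T y) λ z≢0 → contradiction
      (subst₂ ℕ._≤_ (Homog⇒supported hom T y z≢0) ∣τ∣≡0 (SubP.p⊆q⇒∣p∣≤∣q∣ (within (supp T y z≢0)))) λ ()
  δ-acyclic (suc N) {τ} ∣τ∣≡1+N {O} O-δ O-h {n} {z} supp hom cycle with SubP.nonempty? τ
  ... | no empty = contradiction (trans (sym ∣τ∣≡1+N) (trans (cong ∣_∣ (SubP.Empty-unique empty)) (SubP.∣⊥∣≡0 k))) λ ()
  ... | yes (m , m∈τ) = h z ⊕ b′ , supported-⊕ (h-supported supp) (λ T y b′≢0 → forget (supp′ T y b′≢0)) ,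
                        Homog-⊕ (h-Homog hom) hom′ , δb≈z
    where
    open Homotopy {τ} {O} O-δ O-h m∈τ
    w-cycle : ∀ T y → δ (z ⊖ δ (h z)) T y ≡ 0ℤ
    w-cycle T y = trans (δ-⊖ z (δ (h z)) T y) (cong₂ _-_ (cycle T y) (δδ≡0 (h z) T y))
    IH : Σ Chain λ b → SupportedOn (InPiece (τ ∖ m) Remaining) b × Homog (suc (suc n)) b × δ b ≈C (z ⊖ δ (h z))
    IH = δ-acyclic N (ℕP.suc-injective (trans (sym (x∈p⇒∣p∣≡1+∣p∖x∣ m∈τ)) ∣τ∣≡1+N)) Remaining-δ Remaining-h
           (remainder-supported supp cycle) (Homog-⊖ hom (δ-Homog (h-Homog hom))) w-cycle
    b′ : Chain
    b′ = proj₁ IH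
    supp′ : SupportedOn (InPiece (τ ∖ m) Remaining) b′
    supp′ = proj₁ (proj₂ IH)
    hom′ : Homog (suc (suc n)) b′
    hom′ = proj₁ (proj₂ (proj₂ IH))
    δb≈z : δ (h z ⊕ b′) ≈C z
    δb≈z T y = trans (δ-⊕ (h z) b′ T y) (trans (cong (_+_ (δ (h z) T y)) (proj₂ (proj₂ (proj₂ IH)) T y))
      (solve 2 (λ a c → a :+ (c :- a) := c) refl (δ (h z) T y) (z T y)))

  -- The type filtration

  Coprimes : Num → Subset k
  Coprimes y = subsetOf λ j → ¬? (ℓ[ j ]∣? y)

  cellType : Subset k → Num → Subset k
  cellType T y = T ∪ Coprimes y

  ∈-cellType⁺ : ∀ {T y j} → j ∈ T ⊎ ¬ ℓ[ j ]∣ y → j ∈ cellType T y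
  ∈-cellType⁺ (inj₁ j∈T)  = SubP.x∈p∪q⁺ (inj₁ j∈T)
  ∈-cellType⁺ (inj₂ ℓj∤y) = SubP.x∈p∪q⁺ (inj₂ (∈-subsetOf⁺ (λ j → ¬? (ℓ[ j ]∣? _)) ℓj∤y))

  ∈-cellType⁻ : ∀ {T y j} → j ∈ cellType T y → j ∈ T ⊎ ¬ ℓ[ j ]∣ y
  ∈-cellType⁻ {T} {y} j∈ with SubP.x∈p∪q⁻ T (Coprimes y) j∈
  ... | inj₁ j∈T = inj₁ j∈T
  ... | inj₂ j∈C = inj₂ (∈-subsetOf⁻ (λ j → ¬? (ℓ[ j ]∣? y)) j∈C)

  ∉-cellType : ∀ {T y j} → j ∉ T → ℓ[ j ]∣ y → j ∉ cellType T y
  ∉-cellType j∉T ℓj∣y j∈ = [ j∉T , (λ ℓj∤y → ℓj∤y ℓj∣y) ]′ (∈-cellType⁻ j∈)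

  cellType-∪⁅⁆ : ∀ T y i → cellType (T ∪ ⁅ i ⁆) y ≡ cellType T y ∪ ⁅ i ⁆
  cellType-∪⁅⁆ T y i = p∪⁅x⁆∪q≡p∪q∪⁅x⁆ T (Coprimes y) i

  cellType-∪⁅⁆-ℓ[]* : ∀ T y i → cellType (T ∪ ⁅ i ⁆) (ℓ[ i ]* y) ≡ cellType T y ∪ ⁅ i ⁆
  cellType-∪⁅⁆-ℓ[]* T y i = begin
    (T ∪ ⁅ i ⁆) ∪ Coprimes (ℓ[ i ]* y)   ≡⟨ SubP.∪-assoc T ⁅ i ⁆ _ ⟩
    T ∪ (⁅ i ⁆ ∪ Coprimes (ℓ[ i ]* y))   ≡⟨ cong (T ∪_) (SubP.⊆-antisym ⊆ʳ ⊆ˡ) ⟩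
    T ∪ (⁅ i ⁆ ∪ Coprimes y)             ≡⟨ SubP.∪-assoc T ⁅ i ⁆ _ ⟨
    (T ∪ ⁅ i ⁆) ∪ Coprimes y             ≡⟨ cellType-∪⁅⁆ T y i ⟩
    cellType T y ∪ ⁅ i ⁆                 ∎
    where
    open ≡-Reasoning
    move : ∀ {y′ y″} → (∀ {j} → ¬ i ≡ j → ¬ ℓ[ j ]∣ y′ → ¬ ℓ[ j ]∣ y″) →
      ⁅ i ⁆ ∪ Coprimes y′ ⊆ ⁅ i ⁆ ∪ Coprimes y″
    move {y′} {y″} ∤⇒∤ {j} j∈ with SubP.x∈p∪q⁻ ⁅ i ⁆ (Coprimes y′) j∈ | i FinP.≟ j
    ... | _        | yes refl = SubP.x∈p∪q⁺ (inj₁ (SubP.x∈⁅x⁆ i))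
    ... | inj₁ j∈⁅i⁆ | no i≢j = contradiction (sym (SubP.x∈⁅y⁆⇒x≡y i j∈⁅i⁆)) i≢j
    ... | inj₂ j∈C | no i≢j  = SubP.x∈p∪q⁺ (inj₂ (∈-subsetOf⁺ (λ j → ¬? (ℓ[ j ]∣? y″))
                                 (∤⇒∤ i≢j (∈-subsetOf⁻ (λ j → ¬? (ℓ[ j ]∣? y′)) j∈C))))
    ⊆ʳ : ⁅ i ⁆ ∪ Coprimes (ℓ[ i ]* y) ⊆ ⁅ i ⁆ ∪ Coprimes y
    ⊆ʳ = move λ _ ℓj∤ℓiy → ℓj∤ℓiy ∘ ∣-ℓ[]*⁺ i
    ⊆ˡ : ⁅ i ⁆ ∪ Coprimes y ⊆ ⁅ i ⁆ ∪ Coprimes (ℓ[ i ]* y)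
    ⊆ˡ = move λ i≢j ℓj∤y → ℓj∤y ∘ ∣-ℓ[]*⁻ i≢j

  record TypeIdeal : Set₁ where
    field
      Holds    : Subset k → Set
      holds?   : ∀ τ → Dec (Holds τ)
      downward : ∀ {σ τ} → σ ⊆ τ → Holds τ → Holds σ
  open TypeIdeal

  Good : TypeIdeal → Subset k → Num → Set
  Good J T y = Generator T y × Holds J (cellType T y)

  subsetsOf : Subset k → TypeIdeal
  subsetsOf τ = record { Holds = _⊆ τ ; holds? = SubP._⊆? τ ; downward = λ σ⊆ρ ρ⊆τ → ρ⊆τ ∘ σ⊆ρ }

  ∂-supported : ∀ J {c} → SupportedOn (Good J) c → SupportedOn (Good J) (∂ c)
  ∂-supported J {c} supp T y ∂≢0 with ∂-≢0 c T y ∂≢0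
  ... | i , i∉T , inj₁ c≢0 = generator′ (proj₁ (supp _ _ c≢0)) ,
    downward J (subst (cellType T y ⊆_) (sym (cellType-∪⁅⁆ T y i)) (x∈p⇒x∈p∪⁅y⁆ i)) (proj₂ (supp _ _ c≢0))
    where
    generator′ : Generator (T ∪ ⁅ i ⁆) y → Generator T y
    generator′ gen = gen ∘ x∈p⇒x∈p∪⁅y⁆ i
  ... | i , i∉T , inj₂ c≢0 = generator′ (proj₁ (supp _ _ c≢0)) ,
    downward J (subst (cellType T y ⊆_) (sym (cellType-∪⁅⁆-ℓ[]* T y i)) (x∈p⇒x∈p∪⁅y⁆ i)) (proj₂ (supp _ _ c≢0))
    where
    generator′ : Generator (T ∪ ⁅ i ⁆) (ℓ[ i ]* y) → Generator T y
    generator′ gen j∈T = ∣-ℓ[]*⁻ (λ { refl → i∉T j∈T }) (gen (x∈p⇒x∈p∪⁅y⁆ i j∈T))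

  supported-≈ : ∀ {P a b} → a ≈C b → SupportedOn P a → SupportedOn P b
  supported-≈ a≈b supp T y b≢0 = supp T y (b≢0 ∘ trans (sym (a≈b T y)))

  OfType : Subset k → Subset k → Num → Set
  OfType τ T y = Generator T y × cellType T y ≡ τ

  DivisibleOff : Subset k → Subset k → Num → Set
  DivisibleOff τ T y = ∀ {j} → j ∉ τ → ℓ[ j ]∣ y

  DivisibleOff-δ : ∀ τ → δ-Closed τ (DivisibleOff τ)
  DivisibleOff-δ τ i∈τ i∉T div j∉τ = ∣-ℓ[]*⁻ (λ { refl → j∉τ i∈τ }) (div j∉τ)

  DivisibleOff-h : ∀ τ → h-Closed τ (DivisibleOff τ)
  DivisibleOff-h τ {m} m∈τ m∉T div j∉τ = ∣-ℓ[]*⁺ m (div j∉τ)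

  OfType⇒InPiece : ∀ {τ T y} → OfType τ T y → InPiece τ (DivisibleOff τ) T y
  OfType⇒InPiece {y = y} (gen , refl) = record
    { generator = gen
    ; within    = λ j∈T → ∈-cellType⁺ (inj₁ j∈T)
    ; coprime   = λ j∈ j∉T ℓj∣y → ∉-cellType j∉T ℓj∣y j∈
    ; satisfies = λ {j} j∉ → decidable-stable (ℓ[ j ]∣? y) (j∉ ∘ ∈-cellType⁺ ∘ inj₂)
    }

  InPiece⇒OfType : ∀ {τ T y} → InPiece τ (DivisibleOff τ) T y → OfType τ T y
  InPiece⇒OfType {τ} {T} {y} g = generator g , SubP.⊆-antisym ⊆τ τ⊆
    where
    ⊆τ : cellType T y ⊆ τ
    ⊆τ {j} j∈ with ∈-cellType⁻ j∈ | j ∈? τ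
    ... | inj₁ j∈T  | _       = within g j∈T
    ... | inj₂ _    | yes j∈τ = j∈τ
    ... | inj₂ ℓj∤y | no j∉τ  = contradiction (satisfies g j∉τ) ℓj∤y
    τ⊆ : τ ⊆ cellType T y
    τ⊆ {j} j∈τ with j ∈? T
    ... | yes j∈T = ∈-cellType⁺ (inj₁ j∈T)
    ... | no j∉T  = ∈-cellType⁺ (inj₂ (coprime g j∈τ j∉T))

  restrict : Subset k → Chain → Chain
  restrict τ a T x = when (cellType T x ≟S τ) (a T x)

  ∂≡δ-on-type : ∀ {τ b T y} → SupportedOn (OfType τ) b → cellType T y ≡ τ → ∂ b T y ≡ δ b T y
  ∂≡δ-on-type {τ} {b} {T} {y} supp refl = sumFin-cong k term
    where
    ¬OfType : ∀ {i x} → i ∉ T → ℓ[ i ]∣ y → cellType (T ∪ ⁅ i ⁆) x ≡ cellType T y ∪ ⁅ i ⁆ →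
      ¬ OfType τ (T ∪ ⁅ i ⁆) x
    ¬OfType {i} i∉T ℓi∣y eq (_ , type≡τ) =
      ∉-cellType i∉T ℓi∣y (subst (i ∈_) (trans (sym eq) type≡τ) (x∈p∪⁅x⁆ i))
    term : ∀ i → ∂-term b T y i ≡ δ-term b T y i
    term i with i ∈? T | ℓ[ i ]∣? y
    ... | yes _   | _        = refl
    ... | no i∉T  | yes ℓi∣y = trans
      (cong (ω i T *_) (cong₂ _-_ (vanishes-off supp (¬OfType i∉T ℓi∣y (cellType-∪⁅⁆ T y i)))
                                  (vanishes-off supp (¬OfType i∉T ℓi∣y (cellType-∪⁅⁆-ℓ[]* T y i)))))
      (ℤP.*-zeroʳ (ω i T))
    ... | no _    | no ℓi∤y  = trans
      (cong (λ v → ω i T * (v - b (T ∪ ⁅ i ⁆) (ℓ[ i ]* y))) (vanishes-off supp (λ g → ℓi∤y (proj₁ g (x∈p∪⁅x⁆ i)))))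
      (solve 2 (λ w c → w :* (con 0ℤ :- c) := :- (w :* c)) refl (ω i T) (b (T ∪ ⁅ i ⁆) (ℓ[ i ]* y)))

  ∂-restrict : ∀ {τ a T y} → (∀ {i T′ x} → i ∉ τ → cellType T′ x ≡ τ ∪ ⁅ i ⁆ → a T′ x ≡ 0ℤ) →
    cellType T y ≡ τ → ∂ a T y ≡ ∂ (restrict τ a) T y
  ∂-restrict {τ} {a} {T} {y} no-τ∪i refl = sumFin-cong k term
    where
    keep : ∀ {i V x} → cellType V x ≡ τ ∪ ⁅ i ⁆ → a V x ≡ restrict τ a V x
    keep {i} {V} {x} type≡ with cellType V x ≟S τ | i ∈? τ
    ... | yes _     | _      = refl
    ... | no type≢τ | yes i∈τ = contradiction (trans type≡ (x∈p⇒p∪⁅x⁆≡p i∈τ)) type≢τ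
    ... | no _      | no i∉τ  = no-τ∪i i∉τ type≡
    term : ∀ i → ∂-term a T y i ≡ ∂-term (restrict τ a) T y i
    term i with i ∈? T
    ... | yes _ = refl
    ... | no _  = cong (ω i T *_) (cong₂ _-_ (keep (cellType-∪⁅⁆ T y i)) (keep (cellType-∪⁅⁆-ℓ[]* T y i)))

  InOrBelow : TypeIdeal → ℕ → Subset k → Num → Set
  InOrBelow J B T x = Holds J (cellType T x) ⊎ rank (cellType T x) ℕ.< B

  record BoundaryCorrection (K : TypeIdeal) (n : ℕ) (a : Chain) (P : Subset k → Num → Set) : Set where
    constructor correct-by
    field
      correction  : Chain
      supported   : SupportedOn (Good K) correction
      homogeneous : Homog (suc (suc n)) correction
      remainder   : SupportedOn P (a ⊖ ∂ correction)

  zero-correction : ∀ {K n a P} → SupportedOn P a → BoundaryCorrection K n a P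
  zero-correction {a = a} supp = correct-by zeroC supported-0 (λ _ _ _ → refl)
    (supported-≈ (λ T x → sym (trans (cong (_-_ (a T x)) (∂-0 T x)) (ℤP.+-identityʳ (a T x)))) supp)

  ∂-correction : ∀ a b → ∂ (a ⊖ ∂ b) ≈C ∂ a
  ∂-correction a b T y = trans (∂-⊖ a (∂ b) T y) (trans (cong (_-_ (∂ a T y)) (∂∂≡0 b T y)) (ℤP.+-identityʳ _))

  nothing-to-lower : ∀ J B {a} → SupportedOn (InOrBelow J (suc B)) a →
    (∀ T x → ¬ a T x ≡ 0ℤ → rank (cellType T x) ≡ B → Holds J (cellType T x)) → SupportedOn (InOrBelow J B) a
  nothing-to-lower J B below rank-B⇒J T x a≢0 with below T x a≢0 | rank (cellType T x) ℕP.≟ B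
  ... | inj₁ J-type   | _          = inj₁ J-type
  ... | inj₂ _        | yes rank≡B = inj₁ (rank-B⇒J T x a≢0 rank≡B)
  ... | inj₂ rank<1+B | no rank≢B  = inj₂ (ℕP.≤∧≢⇒< (ℕP.≤-pred rank<1+B) rank≢B)

  -- The correction that removes the cells of type τ is a δ-primitive of the type-τ part of a.
  module Elimination (J K : TypeIdeal) {τ : Subset k} (τ∉J : ¬ Holds J τ) (τ∈K : Holds K τ)
    {n : ℕ} {a : Chain} (K-a : SupportedOn (Good K) a) (hom-a : Homog (suc n) a)
    (below : SupportedOn (InOrBelow J (suc (rank τ))) a) (J-∂a : SupportedOn (Good J) (∂ a)) where

    aτ : Chain
    aτ = restrict τ a

    aτ-pure : SupportedOn (OfType τ) aτ
    aτ-pure T x aτ≢0 with when-≢0 (cellType T x ≟S τ) aτ≢0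
    ... | type≡τ , a≢0 = proj₁ (K-a T x a≢0) , type≡τ

    aτ-Homog : Homog (suc n) aτ
    aτ-Homog T x ∣T∣≢ = trans (cong (when (cellType T x ≟S τ)) (hom-a T x ∣T∣≢)) (when-0 (cellType T x ≟S τ))

    no-τ∪i : ∀ {i T x} → i ∉ τ → cellType T x ≡ τ ∪ ⁅ i ⁆ → a T x ≡ 0ℤ
    no-τ∪i {i} i∉τ type≡ = vanishes-off below λ
      { (inj₁ J-type) → τ∉J (downward J (subst (τ ⊆_) (sym type≡) (x∈p⇒x∈p∪⁅y⁆ i)) J-type)
      ; (inj₂ rank<)  → ℕP.<⇒≱ (subst (λ σ → rank σ ℕ.< suc (rank τ)) type≡ rank<)
                                (rank-⊂ (x∈p⇒x∈p∪⁅y⁆ i) λ τ≡ → i∉τ (subst (i ∈_) (sym τ≡) (x∈p∪⁅x⁆ i)))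
      }

    aτ-cycle : ∀ T y → δ aτ T y ≡ 0ℤ
    aτ-cycle T y = ≡0-stable (δ aτ T y) λ δ≢0 →
      τ∉J (subst (Holds J) (type≡τ δ≢0) (proj₂ (J-∂a T y λ ∂a≡0 → δ≢0 (begin
        δ aτ T y                ≡⟨ ∂≡δ-on-type {τ} {aτ} {T} {y} aτ-pure (type≡τ δ≢0) ⟨
        ∂ (restrict τ a) T y    ≡⟨ ∂-restrict {τ} {a} {T} {y} no-τ∪i (type≡τ δ≢0) ⟨
        ∂ a T y                 ≡⟨ ∂a≡0 ⟩
        0ℤ                      ∎))))
      where
      open ≡-Reasoning
      type≡τ : ¬ δ aτ T y ≡ 0ℤ → cellType T y ≡ τ
      type≡τ δ≢0 = proj₂ (InPiece⇒OfType (δ-supported (DivisibleOff-δ τ) (λ T x → OfType⇒InPiece ∘ aτ-pure T x) T y δ≢0))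

    module _ {b : Chain} (b-piece : SupportedOn (InPiece τ (DivisibleOff τ)) b) (δb≈aτ : δ b ≈C aτ) where

      b-pure : SupportedOn (OfType τ) b
      b-pure T x = InPiece⇒OfType ∘ b-piece T x

      K-b : SupportedOn (Good K) b
      K-b T x b≢0 = map₂ (λ type≡τ → subst (Holds K) (sym type≡τ) τ∈K) (b-pure T x b≢0)

      a-∂b-vanishes-on-τ : ∀ T x → cellType T x ≡ τ → a T x - ∂ b T x ≡ 0ℤ
      a-∂b-vanishes-on-τ T x type≡τ = begin
        a T x - ∂ b T x    ≡⟨ cong (_-_ (a T x)) (∂≡δ-on-type {τ} {b} {T} {x} b-pure type≡τ) ⟩
        a T x - δ b T x    ≡⟨ cong (_-_ (a T x)) (δb≈aτ T x) ⟩
        a T x - aτ T x     ≡⟨ cong (_-_ (a T x)) (when-yes (cellType T x ≟S τ) type≡τ) ⟩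
        a T x - a T x      ≡⟨ ℤP.+-inverseʳ (a T x) ⟩
        0ℤ                 ∎
        where open ≡-Reasoning

      ∂b-below : SupportedOn (λ T x → cellType T x ⊆ τ) (∂ b)
      ∂b-below T x = proj₂ ∘ ∂-supported (subsetsOf τ) {b} (λ T x → map₂ SubP.⊆-reflexive ∘ b-pure T x) T x

      a-∂b-below : SupportedOn (InOrBelow J (rank τ)) (a ⊖ ∂ b)
      a-∂b-below T x ≢0 = cases (cellType T x ≟S τ) (≢0-- (a T x) (∂ b T x) ≢0)
        where
        cases : Dec (cellType T x ≡ τ) → ¬ a T x ≡ 0ℤ ⊎ ¬ ∂ b T x ≡ 0ℤ → InOrBelow J (rank τ) T x
        cases (yes type≡τ) _ = contradiction (a-∂b-vanishes-on-τ T x type≡τ) ≢0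
        cases (no type≢τ) (inj₁ a≢0) =
          [ inj₁ , (λ rank<1+τ → inj₂ (ℕP.≤∧≢⇒< (ℕP.≤-pred rank<1+τ) (type≢τ ∘ rank-injective))) ]′ (below T x a≢0)
        cases (no type≢τ) (inj₂ ∂b≢0) = inj₂ (rank-⊂ (∂b-below T x ∂b≢0) type≢τ)

    eliminate : BoundaryCorrection K n a (InOrBelow J (rank τ))
    eliminate = by-primitive (δ-acyclic ∣ τ ∣ {τ} refl {DivisibleOff τ} (DivisibleOff-δ τ) (DivisibleOff-h τ) {n} {aτ}
                               (λ T x → OfType⇒InPiece ∘ aτ-pure T x) aτ-Homog aτ-cycle)
      where
      by-primitive : (Σ Chain λ b → SupportedOn (InPiece τ (DivisibleOff τ)) b × Homog (suc (suc n)) b × δ b ≈C aτ) →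
        BoundaryCorrection K n a (InOrBelow J (rank τ))
      by-primitive (b , b-piece , hom-b , δb≈aτ) = correct-by b (K-b b-piece δb≈aτ) hom-b (a-∂b-below b-piece δb≈aτ)

  lower-rank : ∀ B (J K : TypeIdeal) {n a} → SupportedOn (Good K) a → Homog (suc n) a →
    SupportedOn (InOrBelow J (suc B)) a → SupportedOn (Good J) (∂ a) → BoundaryCorrection K n a (InOrBelow J B)
  lower-rank B J K {n} {a} K-a hom below J-∂a with SubP.anySubset? (λ τ → rank τ ℕP.≟ B)
  ... | no no-rank-B = zero-correction (nothing-to-lower J B below λ T x _ rank≡B → contradiction (cellType T x , rank≡B) no-rank-B)
  ... | yes (τ , rank≡B) with holds? J τ | holds? K τ
  ...   | yes τ∈J | _      = zero-correction (nothing-to-lower J B below λ T x _ rank≡ →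
                               subst (Holds J) (sym (rank-injective (trans rank≡ (sym rank≡B)))) τ∈J)
  ...   | no _    | no τ∉K = zero-correction (nothing-to-lower J B below λ T x a≢0 rank≡ →
                               contradiction (subst (Holds K) (rank-injective (trans rank≡ (sym rank≡B))) (proj₂ (K-a T x a≢0))) τ∉K)
  ...   | no τ∉J  | yes τ∈K = subst (λ B → BoundaryCorrection K n a (InOrBelow J B)) rank≡B
    (Elimination.eliminate J K τ∉J τ∈K K-a hom (subst (λ B → SupportedOn (InOrBelow J (suc B)) a) (sym rank≡B) below) J-∂a)

  relatively-acyclic : ∀ B (J K : TypeIdeal) {n a} → SupportedOn (Good K) a → Homog (suc n) a →
    SupportedOn (InOrBelow J B) a → SupportedOn (Good J) (∂ a) → BoundaryCorrection K n a (Good J)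
  relatively-acyclic zero J K {n} {a} K-a _ below _ =
    zero-correction {K} {n} {a} {Good J} λ T x a≢0 →
      (λ {j} → proj₁ (K-a T x a≢0) {j}) , [ (λ J-type → J-type) , (λ ()) ]′ (below T x a≢0)
  relatively-acyclic (suc B) J K {n} {a} K-a hom below J-∂a = continue (lower-rank B J K K-a hom below J-∂a)
    where
    continue : BoundaryCorrection K n a (InOrBelow J B) → BoundaryCorrection K n a (Good J)
    continue (correct-by b₀ K-b₀ hom₀ below₀) = combine (relatively-acyclic B J K {n} {a ⊖ ∂ b₀}
      (supported-⊖ K-a (∂-supported K K-b₀)) (Homog-⊖ hom (∂-Homog hom₀)) below₀
      (supported-≈ (λ T y → sym (∂-correction a b₀ T y)) J-∂a))
      where
      combine : BoundaryCorrection K n (a ⊖ ∂ b₀) (Good J) → BoundaryCorrection K n a (Good J)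
      combine (correct-by b₁ K-b₁ hom₁ J-rest) =
        correct-by (b₀ ⊕ b₁) (supported-⊕ K-b₀ K-b₁) (Homog-⊕ hom₀ hom₁) (supported-≈ regroup J-rest)
        where
        regroup : ((a ⊖ ∂ b₀) ⊖ ∂ b₁) ≈C (a ⊖ ∂ (b₀ ⊕ b₁))
        regroup T y = trans (solve 3 (λ p q s → (p :- q) :- s := p :- (q :+ s)) refl (a T y) (∂ b₀ T y) (∂ b₁ T y))
                            (cong (_-_ (a T y)) (sym (∂-⊕ b₀ b₁ T y)))

  everything nothing : TypeIdeal
  everything = record { Holds = λ _ → Unit.⊤ ; holds? = λ _ → yes Unit.tt ; downward = λ _ _ → Unit.tt }
  nothing    = record { Holds = λ _ → Empty.⊥ ; holds? = λ _ → no λ () ; downward = λ _ () }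

  listIdeal : (I : List (Subset k)) → OrderIdeal I → TypeIdeal
  listIdeal I I-ideal = record
    { Holds    = λ τ → τ LM.∈ I
    ; holds?   = λ τ → Any.any? (τ ≟S_) I
    ; downward = λ σ⊆τ τ∈I → I-ideal τ∈I σ⊆τ
    }

  InLT-cell : Subset k → Subset k → Num → Set
  InLT-cell T′ T x = T ⊆ T′ × rT T ℕ.* rT (∁ T′) ∣ toℕ x

  InLT-cell⇒Good : ∀ {T′ T x} → InLT-cell T′ T x → Good (subsetsOf T′) T x
  InLT-cell⇒Good {T′} {T} {x} (T⊆T′ , r∣x) = generator′ , type⊆T′
    where
    generator′ : Generator T x
    generator′ j∈T = ℕD.∣-trans (ℕD.∣-trans (prodSub-∈ ℓ j∈T) (ℕD.m∣m*n (rT (∁ T′)))) r∣x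
    type⊆T′ : cellType T x ⊆ T′
    type⊆T′ {j} j∈ with ∈-cellType⁻ j∈ | j ∈? T′
    ... | inj₁ j∈T  | _        = T⊆T′ j∈T
    ... | inj₂ _    | yes j∈T′ = j∈T′
    ... | inj₂ ℓj∤x | no j∉T′  =
      contradiction (ℕD.∣-trans (ℕD.∣-trans (prodSub-∈ ℓ (SubP.x∉p⇒x∈∁p j∉T′)) (ℕD.n∣m*n (rT T))) r∣x) ℓj∤x

  Good⇒InLT-cell : ∀ {T′ T x} → Good (subsetsOf T′) T x → InLT-cell T′ T x
  Good⇒InLT-cell {T′} {T} {x} (gen , type⊆T′) = type⊆T′ ∘ ∈-cellType⁺ ∘ inj₁ ,
    subst (_∣ toℕ x) (sym (prodSub-∪ ℓ disjoint)) (prodSub-∣ ℓ-prime ℓ-injective all-divide)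
    where
    disjoint : ∀ {j} → j ∈ T → j ∉ ∁ T′
    disjoint j∈T = SubP.x∈p⇒x∉∁p (type⊆T′ (∈-cellType⁺ (inj₁ j∈T)))
    all-divide : ∀ {j} → j ∈ T ∪ ∁ T′ → ℓ[ j ]∣ x
    all-divide {j} j∈ with SubP.x∈p∪q⁻ T (∁ T′) j∈
    ... | inj₁ j∈T  = gen j∈T
    ... | inj₂ j∈∁T′ =
      decidable-stable (ℓ[ j ]∣? x) λ ℓj∤x → SubP.x∈∁p⇒x∉p j∈∁T′ (type⊆T′ (∈-cellType⁺ (inj₂ ℓj∤x)))

  ω-⊥ : ∀ i → ω i ⊥ ≡ 1ℤ
  ω-⊥ i = cong sgn (trans (cong ∣_∣ (SubP.∩-zeroˡ (below i))) (SubP.∣⊥∣≡0 k))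

  ∂-at-⊥ : ∀ c y → ∂ c ⊥ y ≡ sumFin k (λ i → sumFin r (λ x → c (⊥ ∪ ⁅ i ⁆) x * rel i x y))
  ∂-at-⊥ c y = sumFin-cong k term
    where
    term : ∀ i → ∂-term c ⊥ y i ≡ sumFin r (λ x → c (⊥ ∪ ⁅ i ⁆) x * rel i x y)
    term i = begin
      ∂-term c ⊥ y i                ≡⟨ unless-no (i ∈? ⊥) (SubP.∉⊥ {x = i}) ⟩
      ω i ⊥ * D                     ≡⟨ trans (cong (_* D) (ω-⊥ i)) (ℤP.*-identityˡ D) ⟩
      D                             ≡⟨ ∑-rel (c (⊥ ∪ ⁅ i ⁆)) i y ⟨
      sumFin r (λ x → c (⊥ ∪ ⁅ i ⁆) x * rel i x y) ∎
      where
      open ≡-Reasoning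
      D : ℤ
      D = c (⊥ ∪ ⁅ i ⁆) y - c (⊥ ∪ ⁅ i ⁆) (ℓ[ i ]* y)

  ~-refl : ∀ f → f ~ f
  ~-refl f = (λ _ _ → 0ℤ) , (λ _ _ _ → refl) , λ y → trans (ℤP.+-inverseʳ (f y)) (sym (sumFin-0 k λ _ → sumFin-0 r λ _ → refl))

  ~-respʳ : ∀ {f g h} → (∀ y → g y ≡ h y) → f ~ g → f ~ h
  ~-respʳ {f} g≗h (C , C-supp , f-g≡) = C , C-supp , λ y → trans (cong (_-_ (f y)) (sym (g≗h y))) (f-g≡ y)

  ~-sym : ∀ {f g} → f ~ g → g ~ f
  ~-sym {f} {g} (C , C-supp , f-g≡) = (λ i x → - C i x) , (λ i x ℓi∤x → cong -_ (C-supp i x ℓi∤x)) , λ y → begin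
    g y - f y                                                 ≡⟨ solve 2 (λ a b → b :- a := :- (a :- b)) refl (f y) (g y) ⟩
    - (f y - g y)                                             ≡⟨ cong -_ (f-g≡ y) ⟩
    - sumFin k (λ i → sumFin r (λ x → C i x * rel i x y))     ≡⟨ sumFin-neg k _ ⟨
    sumFin k (λ i → - sumFin r (λ x → C i x * rel i x y))     ≡⟨ sumFin-cong k (λ i → sumFin-neg r _) ⟨
    sumFin k (λ i → sumFin r (λ x → - (C i x * rel i x y)))
      ≡⟨ sumFin-cong k (λ i → sumFin-cong r λ x → ℤP.neg-distribˡ-* (C i x) (rel i x y)) ⟩
    sumFin k (λ i → sumFin r (λ x → - C i x * rel i x y))     ∎
    where open ≡-Reasoning

  degreeOne : (Fin k → Num → ℤ) → Chain
  degreeOne C T x = sumFin k λ i → when (T ≟S (⊥ ∪ ⁅ i ⁆)) (C i x)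

  module _ (C : Fin k → Num → ℤ) where

    degreeOne-at : ∀ i x → degreeOne C (⊥ ∪ ⁅ i ⁆) x ≡ C i x
    degreeOne-at i x = trans (sumFin-single k i λ j j≢i → when-no (_ ≟S _) (j≢i ∘ sym ∘ ⁅⁆-injective))
      (when-yes ((⊥ ∪ ⁅ i ⁆) ≟S (⊥ ∪ ⁅ i ⁆)) refl)

    degreeOne-≢0 : ∀ T x → ¬ degreeOne C T x ≡ 0ℤ → ∃ λ i → T ≡ ⊥ ∪ ⁅ i ⁆ × ¬ C i x ≡ 0ℤ
    degreeOne-≢0 T x ≢0 with sumFin-≢0 k _ ≢0
    ... | i , when≢0 = i , when-≢0 (T ≟S (⊥ ∪ ⁅ i ⁆)) when≢0

    degreeOne-Homog : Homog 1 (degreeOne C)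
    degreeOne-Homog = supported⇒Homog λ T x ≢0 → singleton (degreeOne-≢0 T x ≢0)
      where
      singleton : ∀ {T x} → ∃ (λ i → T ≡ ⊥ ∪ ⁅ i ⁆ × ¬ C i x ≡ 0ℤ) → ∣ T ∣ ≡ 1
      singleton (i , refl , _) = trans (x∉p⇒∣p∪⁅x⁆∣≡1+∣p∣ {p = ⊥} {x = i} SubP.∉⊥) (cong suc (SubP.∣⊥∣≡0 k))

    degreeOne-generators : (∀ i x → ¬ ℓ[ i ]∣ x → C i x ≡ 0ℤ) → SupportedOn (Good everything) (degreeOne C)
    degreeOne-generators C-supp T x ≢0 = generator′ (degreeOne-≢0 T x ≢0) , Unit.tt
      where
      generator′ : ∃ (λ i → T ≡ ⊥ ∪ ⁅ i ⁆ × ¬ C i x ≡ 0ℤ) → Generator T x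
      generator′ (i , refl , C≢0) {j} j∈ with x∈p∪⁅y⁆⁻ i j∈
      ... | inj₁ refl = decidable-stable (ℓ[ j ]∣? x) (C≢0 ∘ C-supp j x)
      ... | inj₂ j∈⊥  = contradiction j∈⊥ SubP.∉⊥

    ∂-degreeOne : ∀ {c} → Homog 0 c → (∀ y → c ⊥ y ≡ sumFin k (λ i → sumFin r (λ x → C i x * rel i x y))) →
      ∂ (degreeOne C) ≈C c
    ∂-degreeOne {c} hom c≡ T y with ∣ T ∣ ℕP.≟ 0
    ... | no ∣T∣≢0 = trans (∂-Homog degreeOne-Homog T y ∣T∣≢0) (sym (hom T y ∣T∣≢0))
    ... | yes ∣T∣≡0 = subst (λ V → ∂ (degreeOne C) V y ≡ c V y) (sym (∣p∣≡0⇒p≡⊥ {p = T} ∣T∣≡0)) (trans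
      (∂-at-⊥ (degreeOne C) y)
      (trans (sumFin-cong k λ i → sumFin-cong r λ x → cong (_* rel i x y) (degreeOne-at i x)) (sym (c≡ y))))

  module _ (I : List (Subset k)) (I-ideal : OrderIdeal I) where

    InL⇒Good : ∀ {c} → InL I c → SupportedOn (Good (listIdeal I I-ideal)) c
    InL⇒Good {c} (cs , cs∈L , c≈Σcs) T x c≢0 with sumFin-≢0 (length I) (λ j → cs j T x) (c≢0 ∘ trans (c≈Σcs T x))
    ... | j , csj≢0 = map₂ (I-ideal (∈-lookup j)) (InLT-cell⇒Good (decidable-stable
      ((T SubP.⊆? lookup I j) ×-dec (rT T ℕ.* rT (∁ (lookup I j)) ∣? toℕ x)) (csj≢0 ∘ cs∈L j T x)))

    atIndex : ∀ {τ} → Dec (τ LM.∈ I) → Fin (length I) → ℤ → ℤ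
    atIndex (yes τ∈I) j v = when (Any.index τ∈I FinP.≟ j) v
    atIndex (no _)    _ _ = 0ℤ

    Good⇒InL : ∀ {c} → SupportedOn (Good (listIdeal I I-ideal)) c → InL I c
    Good⇒InL {c} supp = component , component∈L , c≈Σcomponent
      where
      type∈I? : ∀ T x → Dec (cellType T x LM.∈ I)
      type∈I? T x = Any.any? (cellType T x ≟S_) I
      component : Fin (length I) → Chain
      component j T x = atIndex (type∈I? T x) j (c T x)
      component-≢0 : ∀ j T x → (d : Dec (cellType T x LM.∈ I)) → ¬ atIndex d j (c T x) ≡ 0ℤ → InLT-cell (lookup I j) T x
      component-≢0 j T x (yes τ∈I) ≢0 with when-≢0 (Any.index τ∈I FinP.≟ j) ≢0
      ... | refl , c≢0 = Good⇒InLT-cell (proj₁ (supp T x c≢0) , SubP.⊆-reflexive (lookup-index τ∈I))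
      component-≢0 j T x (no _) ≢0 = contradiction refl ≢0
      component∈L : ∀ j → InLT (lookup I j) (component j)
      component∈L j T x ¬cell = ≡0-stable _ (¬cell ∘ component-≢0 j T x (type∈I? T x))
      c≈Σcomponent : c ≈C (λ T x → sumFin (length I) (λ j → component j T x))
      c≈Σcomponent T x with type∈I? T x
      ... | yes τ∈I = sym (trans (sumFin-single (length I) (Any.index τ∈I) λ j j≢ → when-no (Any.index τ∈I FinP.≟ j) (j≢ ∘ sym))
                                 (when-yes (Any.index τ∈I FinP.≟ Any.index τ∈I) refl))
      ... | no τ∉I  = trans (vanishes-off supp (τ∉I ∘ proj₂)) (sym (sumFin-0 (length I) λ _ → refl))

    higher-cohomology-vanishes : ∀ n c → InL I c → Homog (suc n) c → dd c ≈C zeroC →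
      Σ Chain λ c′ → InL I c′ × Homog (suc (suc n)) c′ × dd c′ ≈C c
    higher-cohomology-vanishes n c c∈L hom dc≈0 = bounding
      (relatively-acyclic (2 ℕ.^ k) nothing (listIdeal I I-ideal) (InL⇒Good c∈L) hom
        (λ T x _ → inj₂ (rank<2^n (cellType T x))) (λ T y ∂≢0 → contradiction (trans (sym (dd≈∂ c T y)) (dc≈0 T y)) ∂≢0))
      where
      bounding : BoundaryCorrection (listIdeal I I-ideal) n c (Good nothing) →
        Σ Chain λ c′ → InL I c′ × Homog (suc (suc n)) c′ × dd c′ ≈C c
      bounding (correct-by b I-b hom-b nothing-left) = b , Good⇒InL I-b , hom-b ,
        λ T y → trans (dd≈∂ b T y) (sym (ℤP.i-j≡0⇒i≡j (c T y) (∂ b T y) (≡0-stable _ (proj₂ ∘ nothing-left T y))))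

    u-lands-in-U : ∀ c → InL I c → Homog 0 c → InUI I (u c)
    u-lands-in-U c (cs , cs∈L , c≈Σcs) _ =
      (λ j → cs j ⊥) , ⊥-component∈U ,
      ~-respʳ {u c} {u c} {λ x → sumFin (length I) (λ j → cs j ⊥ x)} (c≈Σcs ⊥) (~-refl (u c))
      where
      ⊥-component∈U : ∀ j → InUT (lookup I j) (cs j ⊥)
      ⊥-component∈U j x r∤x = cs∈L j ⊥ x λ (_ , r∣x) →
        r∤x (subst (_∣ toℕ x) (trans (cong (ℕ._* rT (∁ (lookup I j))) (prodSub-⊥ k ℓ)) (ℕP.*-identityˡ _)) r∣x)

    u-kills-boundaries : ∀ c → InL I c → Homog 1 c → u (dd c) ~ zeroU
    u-kills-boundaries c c∈L _ = (λ i → c (⊥ ∪ ⁅ i ⁆)) , singletons-generate ,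
      λ y → trans (ℤP.+-identityʳ _) (trans (dd≈∂ c ⊥ y) (∂-at-⊥ c y))
      where
      singletons-generate : ∀ i x → ¬ ℓ[ i ]∣ x → c (⊥ ∪ ⁅ i ⁆) x ≡ 0ℤ
      singletons-generate i x ℓi∤x = vanishes-off (InL⇒Good c∈L) λ good → ℓi∤x (proj₁ good (x∈p∪⁅x⁆ i))

    u-surjective : ∀ f → InUI I f → Σ Chain λ c → InL I c × Homog 0 c × u c ~ f
    u-surjective f (gs , gs∈U , f~Σgs) = c , (cs , cs∈L , c≈Σcs) , hom ,
      ~-sym {f} {u c} (~-respʳ {f} {λ x → sumFin (length I) λ j → gs j x} {u c} (λ y → sym (at-⊥ y)) f~Σgs)
      where
      cs : Fin (length I) → Chain
      cs j T x = when (T ≟S ⊥) (gs j x)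
      c : Chain
      c T x = when (T ≟S ⊥) (sumFin (length I) λ j → gs j x)
      at-⊥ : ∀ x → c ⊥ x ≡ sumFin (length I) λ j → gs j x
      at-⊥ x = when-yes (⊥ ≟S ⊥) refl
      cs∈L : ∀ j → InLT (lookup I j) (cs j)
      cs∈L j T x ¬cell with T ≟S ⊥
      ... | no _     = refl
      ... | yes refl = gs∈U j x λ r∣x → ¬cell (SubP.⊆-min (lookup I j) ,
        subst (_∣ toℕ x) (sym (trans (cong (ℕ._* rT (∁ (lookup I j))) (prodSub-⊥ k ℓ)) (ℕP.*-identityˡ _))) r∣x)
      c≈Σcs : c ≈C (λ T x → sumFin (length I) (λ j → cs j T x))
      c≈Σcs T x with T ≟S ⊥
      ... | yes _ = refl
      ... | no _  = sym (sumFin-0 (length I) λ _ → refl)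
      hom : Homog 0 c
      hom T x ∣T∣≢0 with T ≟S ⊥
      ... | yes refl = contradiction (SubP.∣⊥∣≡0 k) ∣T∣≢0
      ... | no _     = refl

    u-injective : ∀ c → InL I c → Homog 0 c → u c ~ zeroU → Σ Chain λ c′ → InL I c′ × Homog 1 c′ × dd c′ ≈C c
    u-injective c c∈L hom (C , C-supp , uc≡) =
      via-degreeOne (∂-degreeOne C hom λ y → trans (sym (ℤP.+-identityʳ (c ⊥ y))) (uc≡ y))
      where
      via-degreeOne : ∂ (degreeOne C) ≈C c → Σ Chain λ c′ → InL I c′ × Homog 1 c′ × dd c′ ≈C c
      via-degreeOne ∂c₁≈c = move-into-L
        (relatively-acyclic (2 ℕ.^ k) (listIdeal I I-ideal) everything (degreeOne-generators C C-supp) (degreeOne-Homog C)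
          (λ T x _ → inj₂ (rank<2^n (cellType T x))) (supported-≈ (λ T y → sym (∂c₁≈c T y)) (InL⇒Good c∈L)))
        where
        move-into-L : BoundaryCorrection everything 0 (degreeOne C) (Good (listIdeal I I-ideal)) →
          Σ Chain λ c′ → InL I c′ × Homog 1 c′ × dd c′ ≈C c
        move-into-L (correct-by b _ hom-b I-rest) =
          degreeOne C ⊖ ∂ b , Good⇒InL I-rest , Homog-⊖ (degreeOne-Homog C) (∂-Homog hom-b) ,
          λ T y → trans (dd≈∂ (degreeOne C ⊖ ∂ b) T y) (trans (∂-correction (degreeOne C) b T y) (∂c₁≈c T y))

-- The argument works for any distinct primes.
mainTheorem7 : (k : ℕ) (ℓ : Fin k → ℕ) →
    (∀ i → Prime (ℓ i)) → (∀ i → ¬ (2 ∣ ℓ i)) → Injective _≡_ _≡_ ℓ →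
    (I : List (Subset k)) → OrderIdeal I →
    let open Setup k ℓ in
    -- H^(-n)(L(I)) = 0 for n ≥ 1 (L is concentrated in degrees ≤ 0)
    ((n : ℕ) (c : Chain) → InL I c → Homog (suc n) c → dd c ≈C zeroC →
       Σ Chain λ c' → InL I c' × Homog (suc (suc n)) c' × dd c' ≈C c)
    -- u maps L^0(I) into U_S(I)
    × ((c : Chain) → InL I c → Homog 0 c → InUI I (u c))
    -- u kills d(L^(-1)(I)), so it induces a map on H^0
    × ((c : Chain) → InL I c → Homog 1 c → u (dd c) ~ zeroU)
    -- the induced map H^0(L(I)) → U_S(I) is surjective
    × ((f : FreeU) → InUI I f → Σ Chain λ c → InL I c × Homog 0 c × u c ~ f)
    -- and injective
    × ((c : Chain) → InL I c → Homog 0 c → u c ~ zeroU →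
       Σ Chain λ c' → InL I c' × Homog 1 c' × dd c' ≈C c)
mainTheorem7 k ℓ ℓ-prime _ ℓ-injective I I-ideal =
    higher-cohomology-vanishes I I-ideal
  , u-lands-in-U I I-ideal
  , u-kills-boundaries I I-ideal
  , u-surjective I I-ideal
  , u-injective I I-ideal
  where open Resolution k ℓ ℓ-prime ℓ-injective
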